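{- Let $\Phi$ be the root system of a connected, simply connected, simple complex Lie group, with simple roots $\alpha_1,\dots,\alpha_l$ and Weyl group $W$. A positive root $\alpha$ is in $\tilde{\Phi}^+$ if and only if either $\alpha$ is simple, or there exist $k\ge2$ and $i_1,\dots,i_k\in\{1,\dots,l\}$ such that $$\alpha=s_{i_k}\cdots s_{i_2}(\alpha_{i_1})$$ and $\alpha_{i_{j+1}}\big((s_{i_j}\cdots s_{i_2}(\alpha_{i_1}))^\vee\big)=-1$ for all $1\le j\le k-1$ (where for $j=1$ the root $s_{i_j}\cdots s_{i_2}(\alpha_{i_1})$ means $\alpha_{i_1}$). Moreover, in the latter case the expression $s_\alpha=s_{i_k}\cdots s_{i_2}s_{i_1}s_{i_2}\cdots s_{i_k}$ is reduced, $\alpha^\vee=\alpha_{i_1}^\vee+\dots+\alpha_{i_k}^\vee$ (hence ${\rm ht}(\alpha^\vee)=k$), and all the roots $s_{i_j}\cdots s_{i_2}(\alpha_{i_1})$, $1\le j\le k$, belong to $\tilde{\Phi}^+$.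
   Context: The root system lives in $\mathfrak{t}^*$ where $\mathfrak{t}$ carries a $W$-invariant inner product $\langle\cdot,\cdot\rangle$ identifying $\mathfrak{t}$ with $\mathfrak{t}^*$; the coroot of $\alpha$ is $\alpha^\vee=2\alpha/\langle\alpha,\alpha\rangle$, and $\alpha_1^\vee,\dots,\alpha_l^\vee$ are the simple coroots. $s_i=s_{\alpha_i}$ are the simple reflections and $l(w)$ is the length of $w\in W$ with respect to them. For $\alpha\in\Phi^+$ write $\alpha^\vee=m_1\alpha_1^\vee+\dots+m_l\alpha_l^\vee$ with nonnegative integers $m_i$ and set ${\rm ht}(\alpha^\vee)=m_1+\dots+m_l$. One always has $l(s_\alpha)\le 2{\rm ht}(\alpha^\vee)-1$; $\tilde{\Phi}^+$ denotes the set of positive roots $\alpha$ with $l(s_\alpha)=2{\rm ht}(\alpha^\vee)-1$. -}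

module Defs where

open import Data.Nat using (ℕ; zero; suc)
open import Data.Integer using (ℤ; +_; _+_; _-_; _*_; -_; _≤_; _<_; 0ℤ)
open import Data.Fin using (Fin; _≟_)
import Data.Fin as F
open import Data.Bool using (Bool; true; false; if_then_else_)
open import Data.List using (List; []; _∷_; length; reverse; _++_)
open import Data.Product using (Σ; ∃; ∃₂; _×_; _,_)
open import Data.Unit using (⊤)
open import Relation.Nullary using (¬_; does)
open import Relation.Binary.PropositionalEquality using (_≡_; _≢_)
open import Function using (_∘_)

sumF : ∀ {n} → (Fin n → ℤ) → ℤ
sumF {zero} f = 0ℤ
sumF {suc n} f = f F.zero + sumF (f ∘ F.suc)

-- An irreducible reduced crystallographic root system with l simple roots,
-- presented by the (integer-scaled) Gram matrix B i j = ⟨α_i , α_j⟩ of the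
-- simple roots and the Cartan integers A i j = ⟨α_j , α_i^∨⟩ = 2 B i j / B i i.
-- Vectors of t* are written in coordinates w.r.t. the simple roots.
record RootDatum (l : ℕ) : Set where
  field
    B : Fin l → Fin l → ℤ
    A : Fin l → Fin l → ℤ
    B-sym : ∀ i j → B i j ≡ B j i
    B-posdef : ∀ (x : Fin l → ℤ) → (∃ λ i → x i ≢ 0ℤ) →
               0ℤ < sumF (λ i → sumF (λ j → x i * B i j * x j))
    cartan : ∀ i j → B i i * A i j ≡ + 2 * B i j
    cartan-nonpos : ∀ i j → i ≢ j → A i j ≤ 0ℤ
    nonempty : Fin l
    irreducible : ∀ (S : Fin l → Bool) → (∃ λ i → S i ≡ true) → (∃ λ j → S j ≡ false) →
                  ∃₂ λ i j → S i ≡ true × S j ≡ false × B i j ≢ 0ℤ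

Vect : ℕ → Set
Vect l = Fin l → ℤ

_≋_ : ∀ {l} → Vect l → Vect l → Set
x ≋ y = ∀ j → x j ≡ y j

e : ∀ {l} → Fin l → Vect l
e i j = if does (i ≟ j) then + 1 else 0ℤ

module _ {l : ℕ} (D : RootDatum l) where
  open RootDatum D

  form : Vect l → Vect l → ℤ
  form x y = sumF (λ i → sumF (λ j → x i * B i j * y j))

  pairCo : Vect l → Fin l → ℤ
  pairCo x i = sumF (λ j → x j * A i j)

  sref : Fin l → Vect l → Vect l
  sref i x j = x j - pairCo x i * e i j

  act : List (Fin l) → Vect l → Vect l
  act [] x = x
  act (i ∷ w) x = sref i (act w x)

  IsRoot : Vect l → Set
  IsRoot α = ∃₂ λ (w : List (Fin l)) (i : Fin l) → α ≋ act w (e i)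

  IsPosRoot : Vect l → Set
  IsPosRoot α = IsRoot α × (∀ j → 0ℤ ≤ α j)

  IsSimple : Vect l → Set
  IsSimple α = ∃ λ i → α ≋ e i

  -- m are the coordinates of α^∨ = 2α/⟨α,α⟩ in the simple coroots α_i^∨ = 2α_i/B i i
  CorootCoeffs : Vect l → Vect l → Set
  CorootCoeffs α m = ∀ i → m i * form α α ≡ α i * B i i

  CorootHeight : Vect l → ℤ → Set
  CorootHeight α h = ∃ λ m → CorootCoeffs α m × h ≡ sumF m

  RepresentsRefl : Vect l → List (Fin l) → Set
  RepresentsRefl α w = ∀ x j → form α α * act w x j ≡ form α α * x j - + 2 * form x α * α j

  ReflLength : Vect l → ℕ → Set
  ReflLength α n = (∃ λ w → length w ≡ n × RepresentsRefl α w)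
                 × (∀ w → RepresentsRefl α w → n Data.Nat.≤ length w)

  Reduced : List (Fin l) → Set
  Reduced w = ∀ w' → (∀ x → act w' x ≋ act w x) → length w Data.Nat.≤ length w'

  InTilde : Vect l → Set
  InTilde α = IsPosRoot α × ∃₂ λ n h → ReflLength α n × CorootHeight α h × + n ≡ + 2 * h - + 1

  -- given β_1 = α_{i_1} and rest = [i_2 , … , i_k]:
  -- endRoot = s_{i_k} ⋯ s_{i_2}(α_{i_1})
  endRoot : Vect l → List (Fin l) → Vect l
  endRoot β [] = β
  endRoot β (i ∷ is) = endRoot (sref i β) is

  chainRoots : Vect l → List (Fin l) → List (Vect l)
  chainRoots β [] = β ∷ []
  chainRoots β (i ∷ is) = β ∷ chainRoots (sref i β) is

  -- α_{i_{j+1}}(β_j^∨) = 2⟨α_{i_{j+1}},β_j⟩/⟨β_j,β_j⟩ = -1 for all j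
  GoodChain : Vect l → List (Fin l) → Set
  GoodChain β [] = ⊤
  GoodChain β (i ∷ is) = (+ 2 * form (e i) β ≡ - form β β) × GoodChain (sref i β) is

countIdx : ∀ {l} → Fin l → List (Fin l) → ℕ
countIdx i [] = 0
countIdx i (j ∷ js) = if does (i ≟ j) then suc (countIdx i js) else countIdx i js

reflWord : ∀ {l} → Fin l → List (Fin l) → List (Fin l)
reflWord i₁ rest = reverse rest ++ (i₁ ∷ rest)

{-# OPTIONS --safe #-}
-- Descent: if a positive root α is not simple, pick j with ⟨α , α_j⟩ > 0.  Then s_j α is a
-- positive root with ht((s_j α)^∨) = ht(α^∨) - α_j(α^∨), where α_j(α^∨) ≥ 1, and
-- s_α = s_j s_{s_j α} s_j.  By induction l(s_α) ≤ 2 ht(α^∨) - 1, and equality forces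
-- α_j(α^∨) = 1 at every step, which is the chain condition read backwards.
-- Ascent: along a good chain, α^∨ = α_{i_1}^∨ + ⋯ + α_{i_k}^∨ and the word
-- s_{i_k} ⋯ s_{i_1} ⋯ s_{i_k} of length 2k - 1 inverts 2k - 1 distinct positive roots (each step
-- adds α_i and s_i w(α_i)), so no shorter word represents s_α.
-- Both directions rest on every root being positive or negative, proved by a descent on the
-- positive part of a hypothetical mixed root.
module Submission where

open import Defs
open import Data.Nat as ℕ using (ℕ; zero; suc; z≤n; s≤s)
import Data.Nat.Properties as ℕP
import Data.Nat.Tactic.RingSolver as ℕSolver
open import Data.Integer as ℤ using (ℤ; +_; -[1+_]; +[1+_]; 0ℤ; 1ℤ; -1ℤ; ∣_∣)
import Data.Integer.Properties as ℤP
open import Data.Integer.Tactic.RingSolver using (solve-∀)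
open import Data.Fin using (Fin; zero; suc; _≟_; punchIn)
import Data.Fin.Properties as FP
open import Data.List using (List; []; _∷_; _++_; reverse; length)
import Data.List.Properties as LP
open import Data.List.Relation.Unary.All using (All; []; _∷_)
open import Data.Product using (∃; ∃₂; _×_; _,_; proj₁; proj₂)
open import Data.Sum using (_⊎_; inj₁; inj₂; [_,_]′)
open import Data.Unit using (tt)
open import Data.Empty using (⊥; ⊥-elim)
open import Relation.Nullary using (¬_; Dec; yes; no)
open import Relation.Nullary.Decidable using (¬?; _×-dec_; toSum)
open import Relation.Binary.PropositionalEquality
open import Function using (_∘_)
open import Function.Bundles using (_⇔_; mk⇔)

excess-≮ : ∀ {a b} k → a ≡ b ℕ.+ k → ¬ a ℕ.< b
excess-≮ {b = b} k a≡b+k a<b = ℕP.m+n≮m b k (subst (ℕ._< b) a≡b+k a<b)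

excess-≰ : ∀ {a b} k → a ≡ b ℕ.+ suc k → ¬ a ℕ.≤ b
excess-≰ {b = b} k a≡b+1+k a≤b = ℕP.m+1+n≰m b (subst (ℕ._≤ b) a≡b+1+k a≤b)

-- In each impossible case the left side exceeds the right one by a polynomial with natural
-- coefficients.
module _ where
  open import Data.Nat using (_+_; _*_)

  descent-arith-strictℕ : ∀ n t p u →
    suc n * suc t * suc t + 2 * suc n * suc p * u ℕ.< 2 * suc t + 2 * u →
    n ≡ 0 × t ≡ 0 × (u ≡ 0 ⊎ p ≡ 0)
  descent-arith-strictℕ n (suc t) p u lt = ⊥-elim (excess-≮
    (t * t + 2 * t + n * (2 + t) * (2 + t) + 2 * u * (n + p + n * p)) (difference n t p u) lt)
    where difference : ∀ n t p u → suc n * (2 + t) * (2 + t) + 2 * suc n * suc p * u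
                    ≡ 2 * (2 + t) + 2 * u + (t * t + 2 * t + n * (2 + t) * (2 + t) + 2 * u * (n + p + n * p))
          difference = ℕSolver.solve-∀
  descent-arith-strictℕ (suc n) zero p u lt = ⊥-elim (excess-≮
    (n + 2 * u * (p + suc n * suc p)) (difference n p u) lt)
    where difference : ∀ n p u → (2 + n) * 1 * 1 + 2 * (2 + n) * suc p * u ≡ 2 * 1 + 2 * u + (n + 2 * u * (p + suc n * suc p))
          difference = ℕSolver.solve-∀
  descent-arith-strictℕ zero zero zero    u       lt = refl , refl , inj₂ refl
  descent-arith-strictℕ zero zero (suc p) zero    lt = refl , refl , inj₁ refl
  descent-arith-strictℕ zero zero (suc p) (suc u) lt = ⊥-elim (excess-≮
    (2 * suc u * p + 2 * u + 1) (difference p u) lt)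
    where difference : ∀ p u → 1 * 1 * 1 + 2 * 1 * (2 + p) * suc u ≡ 2 * 1 + 2 * suc u + (2 * suc u * p + 2 * u + 1)
          difference = ℕSolver.solve-∀

  descent-arith-degenerateℕ : ∀ n p u →
    suc n * (2 * suc p) * (2 * suc p) + 2 * suc n * suc p * u ℕ.≤ 2 * (2 * suc p) + 2 * u →
    n ≡ 0 × p ≡ 0
  descent-arith-degenerateℕ zero zero u le = refl , refl
  descent-arith-degenerateℕ n (suc p) u le = ⊥-elim (excess-≰
    (4 * p * p + 12 * p + 7 + 2 * u * (p + 1) + n * (4 * (p + 2) * (p + 2) + 2 * (p + 2) * u)) (difference n p u) le)
    where difference : ∀ n p u → suc n * (2 * (2 + p)) * (2 * (2 + p)) + 2 * suc n * (2 + p) * u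
                    ≡ 2 * (2 * (2 + p)) + 2 * u + suc (4 * p * p + 12 * p + 7 + 2 * u * (p + 1) + n * (4 * (p + 2) * (p + 2) + 2 * (p + 2) * u))
          difference = ℕSolver.solve-∀
  descent-arith-degenerateℕ (suc n) zero u le = ⊥-elim (excess-≰
    (3 + 4 * n + 2 * u * suc n) (difference n u) le)
    where difference : ∀ n u → (2 + n) * (2 * 1) * (2 * 1) + 2 * (2 + n) * 1 * u ≡ 2 * (2 * 1) + 2 * u + suc (3 + 4 * n + 2 * u * suc n)
          difference = ℕSolver.solve-∀

open import Data.Integer using (_+_; _-_; _*_; -_; _≤_; _<_)

*-cancelʳ-≡-pos : ∀ {k} i j → 0ℤ < k → i * k ≡ j * k → i ≡ j
*-cancelʳ-≡-pos {k} i j 0<k = ℤP.*-cancelʳ-≡ i j k {{ℤ.>-nonZero 0<k}}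

*-cancelˡ-≡-pos : ∀ {k} i j → 0ℤ < k → k * i ≡ k * j → i ≡ j
*-cancelˡ-≡-pos {k} i j 0<k eq =
  *-cancelʳ-≡-pos i j 0<k (trans (ℤP.*-comm i k) (trans eq (ℤP.*-comm k j)))

0<i*k⇒0<i : ∀ {i k} → 0ℤ < k → 0ℤ < i * k → 0ℤ < i
0<i*k⇒0<i {i} {k} 0<k h =
  ℤP.*-cancelʳ-<-nonNeg k {{ℤ.nonNegative (ℤP.<⇒≤ 0<k)}} (subst (_< i * k) (sym (ℤP.*-zeroˡ k)) h)

i*k<0⇒i<0 : ∀ {i k} → 0ℤ < k → i * k < 0ℤ → i < 0ℤ
i*k<0⇒i<0 {i} {k} 0<k h =
  ℤP.*-cancelʳ-<-nonNeg k {{ℤ.nonNegative (ℤP.<⇒≤ 0<k)}} (subst (i * k <_) (sym (ℤP.*-zeroˡ k)) h)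

0≤i*k⇒0≤i : ∀ {i k} → 0ℤ < k → 0ℤ ≤ i * k → 0ℤ ≤ i
0≤i*k⇒0≤i {i} {k} 0<k h =
  ℤP.*-cancelʳ-≤-pos 0ℤ i k {{ℤ.positive 0<k}} (subst (_≤ i * k) (sym (ℤP.*-zeroˡ k)) h)

0<i*j⇒0<i×0<j : ∀ {i j} → 0ℤ ≤ i → 0ℤ < i * j → 0ℤ < i × 0ℤ < j
0<i*j⇒0<i×0<j {i} {j} 0≤i h =
  0<i , ℤP.*-cancelˡ-<-nonNeg i {{ℤ.nonNegative 0≤i}} (subst (_< i * j) (sym (ℤP.*-zeroʳ i)) h)
  where
  0<i : 0ℤ < i
  0<i = ℤP.≤∧≢⇒< 0≤i (λ eq → ℤP.<-irrefl refl (subst (λ z → 0ℤ < z * j) (sym eq) h))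

i*j≤0 : ∀ {i j} → 0ℤ ≤ i → j ≤ 0ℤ → i * j ≤ 0ℤ
i*j≤0 {i} 0≤i j≤0 =
  ℤP.≤-trans (ℤP.*-monoˡ-≤-nonNeg i {{ℤ.nonNegative 0≤i}} j≤0) (ℤP.≤-reflexive (ℤP.*-zeroʳ i))

0<i*j : ∀ {i j} → 0ℤ < i → 0ℤ < j → 0ℤ < i * j
0<i*j {i} {j} 0<i 0<j = subst (_< i * j) (ℤP.*-zeroʳ i) (ℤP.*-monoˡ-<-pos i {{ℤ.positive 0<i}} 0<j)

0<j-i⇒i<j : ∀ {i j} → 0ℤ < j - i → i < j
0<j-i⇒i<j {i} {j} 0<j-i = subst₂ _<_ (ℤP.+-identityˡ i) (cancel j i) (ℤP.+-monoˡ-< i 0<j-i)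
  where cancel : ∀ j i → j - i + i ≡ j
        cancel = solve-∀

i*j≡1⇒j≡±1 : ∀ i j → i * j ≡ 1ℤ → j ≡ 1ℤ ⊎ j ≡ -1ℤ
i*j≡1⇒j≡±1 i j eq with ℕP.m*n≡1⇒n≡1 ∣ i ∣ ∣ j ∣ (trans (sym (ℤP.abs-* i j)) (cong ∣_∣ eq))
i*j≡1⇒j≡±1 i (+ .1)     eq | refl = inj₁ refl
i*j≡1⇒j≡±1 i -[1+ 0 ] eq | refl = inj₂ refl

0≰-1 : ¬ (0ℤ ≤ -1ℤ)
0≰-1 ()

sumF-cong : ∀ {n} {f g : Fin n → ℤ} → (∀ i → f i ≡ g i) → sumF f ≡ sumF g
sumF-cong {zero}  h = refl
sumF-cong {suc n} h = cong₂ _+_ (h zero) (sumF-cong (h ∘ suc))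

sumF-zero : ∀ {n} → sumF {n} (λ _ → 0ℤ) ≡ 0ℤ
sumF-zero {zero}  = refl
sumF-zero {suc n} = cong (λ z → 0ℤ + z) (sumF-zero {n})

sumF-+ : ∀ {n} (f g : Fin n → ℤ) → sumF (λ i → f i + g i) ≡ sumF f + sumF g
sumF-+ {zero}  f g = refl
sumF-+ {suc n} f g = trans (cong (λ z → f zero + g zero + z) (sumF-+ (f ∘ suc) (g ∘ suc)))
                           (swap (f zero) (g zero) (sumF (f ∘ suc)) (sumF (g ∘ suc)))
  where
  swap : ∀ a b c d → a + b + (c + d) ≡ a + c + (b + d)
  swap = solve-∀

sumF-neg : ∀ {n} (f : Fin n → ℤ) → sumF (λ i → - f i) ≡ - sumF f
sumF-neg {zero}  f = refl
sumF-neg {suc n} f = trans (cong (λ z → - f zero + z) (sumF-neg (f ∘ suc)))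
                           (sym (ℤP.neg-distrib-+ (f zero) (sumF (f ∘ suc))))

sumF-minus : ∀ {n} (f g : Fin n → ℤ) → sumF (λ i → f i - g i) ≡ sumF f - sumF g
sumF-minus f g = trans (sumF-+ f (λ i → - g i)) (cong (λ z → sumF f + z) (sumF-neg g))

sumF-*ˡ : ∀ {n} c (f : Fin n → ℤ) → sumF (λ i → c * f i) ≡ c * sumF f
sumF-*ˡ {zero}  c f = sym (ℤP.*-zeroʳ c)
sumF-*ˡ {suc n} c f = trans (cong (λ z → c * f zero + z) (sumF-*ˡ c (f ∘ suc)))
                            (sym (ℤP.*-distribˡ-+ c (f zero) (sumF (f ∘ suc))))

sumF-*ʳ : ∀ {n} c (f : Fin n → ℤ) → sumF (λ i → f i * c) ≡ sumF f * c
sumF-*ʳ c f = trans (sumF-cong (λ i → ℤP.*-comm (f i) c))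
                    (trans (sumF-*ˡ c f) (ℤP.*-comm c (sumF f)))

sumF-swap : ∀ {m n} (f : Fin m → Fin n → ℤ) →
  sumF (λ i → sumF (λ j → f i j)) ≡ sumF (λ j → sumF (λ i → f i j))
sumF-swap {zero}  {n} f = sym (sumF-zero {n})
sumF-swap {suc m} {n} f = trans (cong (λ z → sumF (f zero) + z) (sumF-swap (f ∘ suc)))
                                (sym (sumF-+ (f zero) (λ j → sumF (λ i → f (suc i) j))))

sumF-nonNeg : ∀ {n} (f : Fin n → ℤ) → (∀ i → 0ℤ ≤ f i) → 0ℤ ≤ sumF f
sumF-nonNeg {zero}  f h = ℤP.≤-refl
sumF-nonNeg {suc n} f h = ℤP.+-mono-≤ (h zero) (sumF-nonNeg (f ∘ suc) (h ∘ suc))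

sumF-nonPos : ∀ {n} (f : Fin n → ℤ) → (∀ i → f i ≤ 0ℤ) → sumF f ≤ 0ℤ
sumF-nonPos {zero}  f h = ℤP.≤-refl
sumF-nonPos {suc n} f h = ℤP.+-mono-≤ (h zero) (sumF-nonPos (f ∘ suc) (h ∘ suc))

term≤sumF : ∀ {n} (f : Fin n → ℤ) → (∀ i → 0ℤ ≤ f i) → ∀ k → f k ≤ sumF f
term≤sumF {suc n} f h zero =
  ℤP.≤-trans (ℤP.≤-reflexive (sym (ℤP.+-identityʳ (f zero))))
             (ℤP.+-monoʳ-≤ (f zero) (sumF-nonNeg (f ∘ suc) (h ∘ suc)))
term≤sumF {suc n} f h (suc k) =
  ℤP.≤-trans (term≤sumF (f ∘ suc) (h ∘ suc) k)
             (subst (_≤ sumF f) (ℤP.+-identityˡ (sumF (f ∘ suc))) (ℤP.+-monoˡ-≤ (sumF (f ∘ suc)) (h zero)))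

sumF≤term : ∀ {n} (f : Fin n → ℤ) → (∀ i → f i ≤ 0ℤ) → ∀ k → sumF f ≤ f k
sumF≤term f h k = ℤP.neg-cancel-≤ (subst (- f k ≤_) (sumF-neg f)
  (term≤sumF (λ i → - f i) (λ i → ℤP.neg-mono-≤ (h i)) k))

0<sumF⇒∃0< : ∀ {n} (f : Fin n → ℤ) → 0ℤ < sumF f → ∃ λ i → 0ℤ < f i
0<sumF⇒∃0< f 0<Σf with FP.any? (λ i → 0ℤ ℤP.<? f i)
... | yes found = found
... | no none = ⊥-elim (ℤP.<⇒≱ 0<Σf (sumF-nonPos f (λ i → ℤP.≮⇒≥ (λ lt → none (i , lt)))))

pos-part neg-part : ℤ → ℤ
pos-part (+ n)    = + n
pos-part -[1+ n ] = 0ℤ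
neg-part (+ n)    = 0ℤ
neg-part -[1+ n ] = +[1+ n ]

pos-part-neg-part : ∀ z → z ≡ pos-part z - neg-part z
pos-part-neg-part (+ n)    = sym (ℤP.+-identityʳ (+ n))
pos-part-neg-part -[1+ n ] = refl

pos-part-nonNeg : ∀ z → 0ℤ ≤ pos-part z
pos-part-nonNeg (+ n)    = ℤ.+≤+ z≤n
pos-part-nonNeg -[1+ n ] = ℤP.≤-refl

neg-part-nonNeg : ∀ z → 0ℤ ≤ neg-part z
neg-part-nonNeg (+ n)    = ℤP.≤-refl
neg-part-nonNeg -[1+ n ] = ℤ.+≤+ z≤n

0<⇒pos-part≡ : ∀ {z} → 0ℤ < z → pos-part z ≡ z
0<⇒pos-part≡ {+ n} _ = refl

0<pos-part⇒0< : ∀ {z} → 0ℤ < pos-part z → 0ℤ < z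
0<pos-part⇒0< {+ n} 0<z = 0<z
0<pos-part⇒0< { -[1+ n ]} (ℤ.+<+ ())

0<pos-part⇒neg-part≡0 : ∀ {z} → 0ℤ < pos-part z → neg-part z ≡ 0ℤ
0<pos-part⇒neg-part≡0 {+ n} _ = refl
0<pos-part⇒neg-part≡0 { -[1+ n ]} (ℤ.+<+ ())

<0⇒0<neg-part : ∀ {z} → z < 0ℤ → 0ℤ < neg-part z
<0⇒0<neg-part { -[1+ n ]} _ = ℤ.+<+ (s≤s z≤n)
<0⇒0<neg-part {+ n} (ℤ.+<+ ())

≤0⇒pos-part≡0 : ∀ {z} → z ≤ 0ℤ → pos-part z ≡ 0ℤ
≤0⇒pos-part≡0 {+ zero}   _ = refl
≤0⇒pos-part≡0 { -[1+ n ]} _ = refl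
≤0⇒pos-part≡0 {+[1+ n ]} (ℤ.+≤+ ())

pos-part-pred : ∀ {z} → 0ℤ < z → pos-part (z - 1ℤ) ≡ pos-part z - 1ℤ
pos-part-pred {+[1+ n ]} _ = refl
pos-part-pred {+ zero} (ℤ.+<+ ())

i-j≡2⇒i≡1 : ∀ {i j} → i - j ≡ + 2 → 0ℤ < i → j < 0ℤ → i ≡ 1ℤ
i-j≡2⇒i≡1 {i} {j} i-j≡2 0<i j<0 = ℤP.≤-antisym i≤1 (ℤP.i<j⇒suc[i]≤j 0<i)
  where
  shift : ∀ i j → i ≡ i - j + j
  shift = solve-∀
  reorder : ∀ j → + 2 + j ≡ 1ℤ + j + 1ℤ
  reorder = solve-∀
  i≤1 : i ≤ 1ℤ
  i≤1 = subst (_≤ 1ℤ) (sym (trans (shift i j) (trans (cong (_+ j) i-j≡2) (reorder j))))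
              (ℤP.+-monoˡ-≤ 1ℤ (ℤP.i<j⇒suc[i]≤j j<0))

SomePos : ∀ {l} → Vect l → Set
SomePos x = ∃ λ j → 0ℤ < x j

0<⇒+[1+] : ∀ {i} → 0ℤ < i → ∃ λ n → i ≡ +[1+ n ]
0<⇒+[1+] {+[1+ n ]} _ = n , refl
0<⇒+[1+] {+ zero} (ℤ.+<+ ())

0≤⇒+ : ∀ {i} → 0ℤ ≤ i → ∃ λ n → i ≡ + n
0≤⇒+ {+ n} _ = n , refl

+-cast-bound-lhs : ∀ a b c d → + a * + b * + b + + 2 * + a * + c * + d ≡ + (a ℕ.* b ℕ.* b ℕ.+ 2 ℕ.* a ℕ.* c ℕ.* d)
+-cast-bound-lhs a b c d = sym (begin
  + (a ℕ.* b ℕ.* b ℕ.+ 2 ℕ.* a ℕ.* c ℕ.* d)   ≡⟨ ℤP.pos-+ (a ℕ.* b ℕ.* b) (2 ℕ.* a ℕ.* c ℕ.* d) ⟩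
  + (a ℕ.* b ℕ.* b) + + (2 ℕ.* a ℕ.* c ℕ.* d) ≡⟨ cong₂ _+_ (trans (ℤP.pos-* (a ℕ.* b) b) (cong (_* + b) (ℤP.pos-* a b)))
                                                             (trans (ℤP.pos-* (2 ℕ.* a ℕ.* c) d)
                                                               (cong (_* + d) (trans (ℤP.pos-* (2 ℕ.* a) c) (cong (_* + c) (ℤP.pos-* 2 a))))) ⟩
  + a * + b * + b + + 2 * + a * + c * + d        ∎)
  where open ≡-Reasoning

+-cast-bound-rhs : ∀ b d → + 2 * + b + + 2 * + d ≡ + (2 ℕ.* b ℕ.+ 2 ℕ.* d)
+-cast-bound-rhs b d = sym (trans (ℤP.pos-+ (2 ℕ.* b) (2 ℕ.* d)) (cong₂ _+_ (ℤP.pos-* 2 b) (ℤP.pos-* 2 d)))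

descent-arith-strict : ∀ {n t p u} → 0ℤ < n → 0ℤ < t → 0ℤ < p → 0ℤ ≤ u →
  n * t * t + + 2 * n * p * u < + 2 * t + + 2 * u → n ≡ 1ℤ × t ≡ 1ℤ × (u ≡ 0ℤ ⊎ p ≡ 1ℤ)
descent-arith-strict 0<n 0<t 0<p 0≤u lt
  with 0<⇒+[1+] 0<n | 0<⇒+[1+] 0<t | 0<⇒+[1+] 0<p | 0≤⇒+ 0≤u
... | n , refl | t , refl | p , refl | u , refl
  with descent-arith-strictℕ n t p u
         (ℤP.drop‿+<+ (subst₂ _<_ (+-cast-bound-lhs (suc n) (suc t) (suc p) u) (+-cast-bound-rhs (suc t) u) lt))
... | refl , refl , inj₁ refl = refl , refl , inj₁ refl
... | refl , refl , inj₂ refl = refl , refl , inj₂ refl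

descent-arith-degenerate : ∀ {n p u} → 0ℤ < n → 0ℤ < p → 0ℤ ≤ u →
  n * (+ 2 * p) * (+ 2 * p) + + 2 * n * p * u ≤ + 2 * (+ 2 * p) + + 2 * u → n ≡ 1ℤ × p ≡ 1ℤ
descent-arith-degenerate 0<n 0<p 0≤u le
  with 0<⇒+[1+] 0<n | 0<⇒+[1+] 0<p | 0≤⇒+ 0≤u
... | n , refl | p , refl | u , refl
  with descent-arith-degenerateℕ n p u (ℤP.drop‿+≤+ (subst₂ _≤_
         (trans (cong (λ z → +[1+ n ] * z * z + + 2 * +[1+ n ] * +[1+ p ] * + u) (sym (ℤP.pos-* 2 (suc p))))
                (+-cast-bound-lhs (suc n) (2 ℕ.* suc p) (suc p) u))
         (trans (cong (λ z → + 2 * z + + 2 * + u) (sym (ℤP.pos-* 2 (suc p)))) (+-cast-bound-rhs (2 ℕ.* suc p) u))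
         le))
... | refl , refl = refl , refl

length-bound-conj : ∀ L S n → 1ℤ ≤ n → L + 1ℤ ≤ + 2 * (S - n) → + 2 + L + 1ℤ ≤ + 2 * S
length-bound-conj L S n 1≤n bound = begin
  + 2 + L + 1ℤ            ≡⟨ regroup L ⟩
  L + 1ℤ + + 2 * 1ℤ       ≤⟨ ℤP.+-mono-≤ bound (ℤP.*-monoˡ-≤-nonNeg (+ 2) 1≤n) ⟩
  + 2 * (S - n) + + 2 * n ≡⟨ cancel S n ⟩
  + 2 * S                 ∎
  where
  open ℤP.≤-Reasoning
  regroup : ∀ L → + 2 + L + 1ℤ ≡ L + 1ℤ + + 2 * 1ℤ
  regroup = solve-∀
  cancel : ∀ S n → + 2 * (S - n) + + 2 * n ≡ + 2 * S
  cancel = solve-∀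

length-bound-conj-tight : ∀ L S n → 1ℤ ≤ n → + 2 * S - 1ℤ ≤ + 2 + L → L + 1ℤ ≤ + 2 * (S - n) → n ≡ 1ℤ
length-bound-conj-tight L S n 1≤n lower upper = ℤP.≤-antisym (ℤP.*-cancelˡ-≤-pos n 1ℤ (+ 2) 2n≤2) 1≤n
  where
  open ℤP.≤-Reasoning
  2n≤2 : + 2 * n ≤ + 2 * 1ℤ
  2n≤2 = begin
    + 2 * n                            ≡⟨ add-sub (+ 2 * n) (L + 1ℤ) ⟩
    + 2 * n + (L + 1ℤ) - (L + 1ℤ)      ≤⟨ ℤP.+-monoˡ-≤ (- (L + 1ℤ)) (ℤP.+-monoʳ-≤ (+ 2 * n) upper) ⟩
    + 2 * n + + 2 * (S - n) - (L + 1ℤ) ≡⟨ regroup n S L ⟩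
    + 2 * S - 1ℤ - L                   ≤⟨ ℤP.+-monoˡ-≤ (- L) lower ⟩
    + 2 + L - L                        ≡⟨ cancel L ⟩
    + 2 * 1ℤ                           ∎
    where
    add-sub : ∀ a b → a ≡ a + b - b
    add-sub = solve-∀
    regroup : ∀ n S L → + 2 * n + + 2 * (S - n) - (L + 1ℤ) ≡ + 2 * S - 1ℤ - L
    regroup = solve-∀
    cancel : ∀ L → + 2 + L - L ≡ + 2 * 1ℤ
    cancel = solve-∀

length-lower-conj : ∀ V S → + 2 * S - 1ℤ ≤ + 2 + V → + 2 * (S - 1ℤ) - 1ℤ ≤ V
length-lower-conj V S lower = begin
  + 2 * (S - 1ℤ) - 1ℤ ≡⟨ regroup S ⟩
  + 2 * S - 1ℤ - + 2  ≤⟨ ℤP.+-monoˡ-≤ (- + 2) lower ⟩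
  + 2 + V - + 2       ≡⟨ cancel V ⟩
  V                   ∎
  where
  open ℤP.≤-Reasoning
  regroup : ∀ S → + 2 * (S - 1ℤ) - 1ℤ ≡ + 2 * S - 1ℤ - + 2
  regroup = solve-∀
  cancel : ∀ V → + 2 + V - + 2 ≡ V
  cancel = solve-∀

≋-refl : ∀ {l} {x : Vect l} → x ≋ x
≋-refl j = refl

≋-sym : ∀ {l} {x y : Vect l} → x ≋ y → y ≋ x
≋-sym h j = sym (h j)

≋-trans : ∀ {l} {x y z : Vect l} → x ≋ y → y ≋ z → x ≋ z
≋-trans h h′ j = trans (h j) (h′ j)

e-diag : ∀ {n} (i : Fin n) → e i i ≡ 1ℤ
e-diag zero    = refl
e-diag (suc i) = e-diag i

e-off : ∀ {n} (i j : Fin n) → i ≢ j → e i j ≡ 0ℤ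
e-off i j i≢j with i ≟ j
... | yes i≡j = ⊥-elim (i≢j i≡j)
... | no _    = refl

e-nonNeg : ∀ {n} (i j : Fin n) → 0ℤ ≤ e i j
e-nonNeg i j with i ≟ j
... | yes _ = ℤ.+≤+ z≤n
... | no _  = ℤ.+≤+ z≤n

≋e-intro : ∀ {n} {x : Fin n → ℤ} i → x i ≡ 1ℤ → (∀ k → i ≢ k → x k ≡ 0ℤ) → x ≋ e i
≋e-intro i xi≡1 off k with i ≟ k
... | yes refl = xi≡1
... | no i≢k   = off k i≢k

supported-at⇒≋*e : ∀ {n} {β : Fin n → ℤ} i → (∀ j → i ≢ j → β j ≡ 0ℤ) → β ≋ (λ j → β i * e i j)
supported-at⇒≋*e {β = β} i off j with i ≟ j
... | yes refl = sym (ℤP.*-identityʳ (β i))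
... | no i≢j  = trans (off j i≢j) (sym (ℤP.*-zeroʳ (β i)))

e-*-cong : ∀ {n} (i k : Fin n) {x y : ℤ} → (i ≡ k → x ≡ y) → e i k * x ≡ e i k * y
e-*-cong i k {x} {y} h with i ≟ k
... | yes i≡k = cong (1ℤ *_) (h i≡k)
... | no _    = trans (ℤP.*-zeroˡ x) (sym (ℤP.*-zeroˡ y))

sumF-*e : ∀ {n} (f : Fin n → ℤ) (i : Fin n) → sumF (λ j → f j * e i j) ≡ f i
sumF-*e {suc n} f zero = trans
  (cong₂ _+_ (ℤP.*-identityʳ (f zero)) (trans (sumF-cong (λ j → ℤP.*-zeroʳ (f (suc j)))) (sumF-zero {n})))
  (ℤP.+-identityʳ (f zero))
sumF-*e {suc n} f (suc i) = trans
  (cong₂ _+_ (ℤP.*-zeroʳ (f zero)) (sumF-*e (f ∘ suc) i))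
  (ℤP.+-identityˡ (f (suc i)))

sumF-e* : ∀ {n} (f : Fin n → ℤ) (i : Fin n) → sumF (λ j → e i j * f j) ≡ f i
sumF-e* f i = trans (sumF-cong (λ j → ℤP.*-comm (e i j) (f j))) (sumF-*e f i)

sumF-e : ∀ {n} (i : Fin n) → sumF (e i) ≡ 1ℤ
sumF-e i = trans (sumF-cong (λ j → sym (ℤP.*-identityˡ (e i j)))) (sumF-*e (λ _ → 1ℤ) i)

countIdx-cons : ∀ {n} (k i : Fin n) is → + countIdx k (i ∷ is) ≡ e i k + + countIdx k is
countIdx-cons k i is with k ≟ i
... | yes refl = sym (cong (_+ + countIdx k is) (e-diag k))
... | no k≢i   = sym (trans (cong (_+ + countIdx k is) (e-off i k (λ i≡k → k≢i (sym i≡k)))) (ℤP.+-identityˡ _))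

sumF-countIdx : ∀ {n} (is : List (Fin n)) → sumF (λ k → + countIdx k is) ≡ + length is
sumF-countIdx {n} []       = sumF-zero {n}
sumF-countIdx (i ∷ is) = begin
  sumF (λ k → + countIdx k (i ∷ is))        ≡⟨ sumF-cong (λ k → countIdx-cons k i is) ⟩
  sumF (λ k → e i k + + countIdx k is)      ≡⟨ sumF-+ (e i) (λ k → + countIdx k is) ⟩
  sumF (e i) + sumF (λ k → + countIdx k is) ≡⟨ cong₂ _+_ (sumF-e i) (sumF-countIdx is) ⟩
  + suc (length is)                         ∎
  where open ≡-Reasoning

length-conj : ∀ {A : Set} (j : A) w → length (j ∷ w ++ j ∷ []) ≡ 2 ℕ.+ length w
length-conj j w = cong suc (trans (LP.length-++ w) (ℕP.+-comm (length w) 1))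

AllNonNeg AllNonPos SomeNeg : ∀ {l} → Vect l → Set
AllNonNeg x = ∀ j → 0ℤ ≤ x j
AllNonPos x = ∀ j → x j ≤ 0ℤ
SomeNeg x = ∃ λ j → x j < 0ℤ

SomeNeg? : ∀ {l} (x : Vect l) → Dec (SomeNeg x)
SomeNeg? x = FP.any? (λ j → x j ℤP.<? 0ℤ)

AllNonNeg⇒¬SomeNeg : ∀ {l} {x : Vect l} → AllNonNeg x → ¬ SomeNeg x
AllNonNeg⇒¬SomeNeg x≥0 (j , xj<0) = ℤP.<⇒≱ xj<0 (x≥0 j)

¬SomeNeg⇒AllNonNeg : ∀ {l} {x : Vect l} → ¬ SomeNeg x → AllNonNeg x
¬SomeNeg⇒AllNonNeg ¬neg j = ℤP.≮⇒≥ (λ xj<0 → ¬neg (j , xj<0))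

AllNonNeg-cong : ∀ {l} {x y : Vect l} → x ≋ y → AllNonNeg x → AllNonNeg y
AllNonNeg-cong x≋y x≥0 j = subst (0ℤ ≤_) (x≋y j) (x≥0 j)

SomeNeg-cong : ∀ {l} {x y : Vect l} → x ≋ y → SomeNeg x → SomeNeg y
SomeNeg-cong x≋y (j , xj<0) = j , subst (_< 0ℤ) (x≋y j) xj<0

≋-dec : ∀ {l} (x y : Vect l) → Dec (x ≋ y)
≋-dec x y = FP.all? (λ j → x j ℤ.≟ y j)

module _ {l : ℕ} (D : RootDatum l) where
  open RootDatum D

  form-cong : ∀ {x x′ y y′} → x ≋ x′ → y ≋ y′ → form D x y ≡ form D x′ y′
  form-cong hx hy = sumF-cong (λ i → sumF-cong (λ j → cong₂ (λ a b → a * B i j * b) (hx i) (hy j)))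

  form-sym : ∀ x y → form D x y ≡ form D y x
  form-sym x y = trans (sumF-swap (λ i j → x i * B i j * y j))
                       (sumF-cong (λ j → sumF-cong (λ i → swap i j)))
    where
    swap : ∀ i j → x i * B i j * y j ≡ y j * B j i * x i
    swap i j rewrite B-sym i j = reorder (x i) (B j i) (y j)
      where reorder : ∀ a b c → a * b * c ≡ c * b * a
            reorder = solve-∀

  form-e : ∀ i y → form D (e i) y ≡ sumF (λ j → B i j * y j)
  form-e i y = trans (sumF-cong (λ k → trans (sumF-cong (λ j → ℤP.*-assoc (e i k) (B k j) (y j)))
                                             (sumF-*ˡ (e i k) (λ j → B k j * y j))))
                     (sumF-e* (λ k → sumF (λ j → B k j * y j)) i)

  form-expand : ∀ x y → form D x y ≡ sumF (λ i → x i * form D (e i) y)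
  form-expand x y = sumF-cong (λ i → trans
    (sumF-cong (λ j → ℤP.*-assoc (x i) (B i j) (y j)))
    (trans (sumF-*ˡ (x i) (λ j → B i j * y j)) (cong (x i *_) (sym (form-e i y)))))

  form-ee : ∀ i j → form D (e i) (e j) ≡ B i j
  form-ee i j = trans (form-e i (e j)) (sumF-*e (B i) j)

  form-+ˡ : ∀ x y z → form D (λ j → x j + y j) z ≡ form D x z + form D y z
  form-+ˡ x y z = begin
    form D (λ j → x j + y j) z
      ≡⟨ form-expand (λ j → x j + y j) z ⟩
    sumF (λ i → (x i + y i) * form D (e i) z)
      ≡⟨ sumF-cong (λ i → ℤP.*-distribʳ-+ (form D (e i) z) (x i) (y i)) ⟩
    sumF (λ i → x i * form D (e i) z + y i * form D (e i) z)
      ≡⟨ sumF-+ (λ i → x i * form D (e i) z) (λ i → y i * form D (e i) z) ⟩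
    sumF (λ i → x i * form D (e i) z) + sumF (λ i → y i * form D (e i) z)
      ≡⟨ cong₂ _+_ (sym (form-expand x z)) (sym (form-expand y z)) ⟩
    form D x z + form D y z
      ∎
    where open ≡-Reasoning

  form-zeroˡ : ∀ z → form D (λ _ → 0ℤ) z ≡ 0ℤ
  form-zeroˡ z = trans (form-expand (λ _ → 0ℤ) z)
                       (trans (sumF-cong (λ i → ℤP.*-zeroˡ (form D (e i) z))) (sumF-zero {l}))

  form-*ˡ : ∀ c x z → form D (λ j → c * x j) z ≡ c * form D x z
  form-*ˡ c x z = begin
    form D (λ j → c * x j) z                ≡⟨ form-expand (λ j → c * x j) z ⟩
    sumF (λ i → c * x i * form D (e i) z)   ≡⟨ sumF-cong (λ i → ℤP.*-assoc c (x i) (form D (e i) z)) ⟩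
    sumF (λ i → c * (x i * form D (e i) z)) ≡⟨ sumF-*ˡ c (λ i → x i * form D (e i) z) ⟩
    c * sumF (λ i → x i * form D (e i) z)   ≡⟨ cong (c *_) (sym (form-expand x z)) ⟩
    c * form D x z                          ∎
    where open ≡-Reasoning

  form-negˡ : ∀ x z → form D (λ j → - x j) z ≡ - form D x z
  form-negˡ x z = trans (form-cong (λ j → sym (ℤP.-1*i≡-i (x j))) ≋-refl)
                        (trans (form-*ˡ -1ℤ x z) (ℤP.-1*i≡-i (form D x z)))

  form-minusˡ : ∀ x y z → form D (λ j → x j - y j) z ≡ form D x z - form D y z
  form-minusˡ x y z = trans (form-+ˡ x (λ j → - y j) z) (cong (λ w → form D x z + w) (form-negˡ y z))

  form-minus-*ˡ : ∀ x c y z → form D (λ j → x j - c * y j) z ≡ form D x z - c * form D y z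
  form-minus-*ˡ x c y z = trans (form-minusˡ x (λ j → c * y j) z) (cong (λ w → form D x z - w) (form-*ˡ c y z))

  form-minusʳ : ∀ z x y → form D z (λ j → x j - y j) ≡ form D z x - form D z y
  form-minusʳ z x y = trans (form-sym z (λ j → x j - y j))
    (trans (form-minusˡ x y z) (cong₂ _-_ (form-sym x z) (form-sym y z)))

  form-*ʳ : ∀ c z x → form D z (λ j → c * x j) ≡ c * form D z x
  form-*ʳ c z x = trans (form-sym z (λ j → c * x j)) (trans (form-*ˡ c x z) (cong (c *_) (form-sym x z)))

  form-minus-*ʳ : ∀ z x c y → form D z (λ j → x j - c * y j) ≡ form D z x - c * form D z y
  form-minus-*ʳ z x c y = trans (form-sym z (λ j → x j - c * y j))
    (trans (form-minus-*ˡ x c y z) (cong₂ (λ a b → a - c * b) (form-sym x z) (form-sym y z)))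

  positive-direction : ∀ {x} → AllNonNeg x → 0ℤ < form D x x → ∃ λ j → 0ℤ < x j × 0ℤ < form D (e j) x
  positive-direction {x} x≥0 0<xx =
    let (j , 0<term) = 0<sumF⇒∃0< _ (subst (0ℤ <_) (form-expand x x) 0<xx) in j , 0<i*j⇒0<i×0<j (x≥0 j) 0<term

  B-diag-pos : ∀ i → 0ℤ < B i i
  B-diag-pos i = subst (0ℤ <_) (form-ee i i) (B-posdef (e i) (i , λ eii≡0 → 1≢0 (trans (sym (e-diag i)) eii≡0)))
    where 1≢0 : 1ℤ ≢ 0ℤ
          1≢0 ()

  A-diag : ∀ i → A i i ≡ + 2
  A-diag i = *-cancelˡ-≡-pos (A i i) (+ 2) (B-diag-pos i) (trans (cartan i i) (ℤP.*-comm (+ 2) (B i i)))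

  B-off-nonPos : ∀ i j → i ≢ j → B i j ≤ 0ℤ
  B-off-nonPos i j i≢j = ℤP.≮⇒≥ λ 0<Bij → ℤP.<⇒≱ (2Bij>0 0<Bij) BiiAij≤0
    where
    BiiAij≤0 : B i i * A i j ≤ 0ℤ
    BiiAij≤0 = i*j≤0 (ℤP.<⇒≤ (B-diag-pos i)) (cartan-nonpos i j i≢j)
    2Bij>0 : 0ℤ < B i j → 0ℤ < B i i * A i j
    2Bij>0 0<Bij = subst (0ℤ <_) (sym (cartan i j)) (0<i*j {+ 2} (ℤ.+<+ (s≤s z≤n)) 0<Bij)

  pairCo-cartan : ∀ x i → pairCo D x i * B i i ≡ + 2 * form D x (e i)
  pairCo-cartan x i = begin
    sumF (λ j → x j * A i j) * B i i ≡⟨ sym (sumF-*ʳ (B i i) (λ j → x j * A i j)) ⟩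
    sumF (λ j → x j * A i j * B i i) ≡⟨ sumF-cong step ⟩
    sumF (λ j → + 2 * (B i j * x j)) ≡⟨ sumF-*ˡ (+ 2) (λ j → B i j * x j) ⟩
    + 2 * sumF (λ j → B i j * x j)   ≡⟨ cong (+ 2 *_) (sym (form-e i x)) ⟩
    + 2 * form D (e i) x             ≡⟨ cong (+ 2 *_) (form-sym (e i) x) ⟩
    + 2 * form D x (e i)             ∎
    where
    open ≡-Reasoning
    step : ∀ j → x j * A i j * B i i ≡ + 2 * (B i j * x j)
    step j = trans (reorder (x j) (A i j) (B i i))
                   (trans (cong (_* x j) (cartan i j)) (ℤP.*-assoc (+ 2) (B i j) (x j)))
      where reorder : ∀ a b c → a * b * c ≡ c * b * a
            reorder = solve-∀

  pairCo-cong : ∀ {x y} → x ≋ y → ∀ i → pairCo D x i ≡ pairCo D y i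
  pairCo-cong x≋y i = sumF-cong (λ j → cong (_* A i j) (x≋y j))

  pairCo-e : ∀ i k → pairCo D (e i) k ≡ A k i
  pairCo-e i k = trans (sumF-cong (λ j → ℤP.*-comm (e i j) (A k j))) (sumF-*e (A k) i)

  pairCo-+ : ∀ x y k → pairCo D (λ j → x j + y j) k ≡ pairCo D x k + pairCo D y k
  pairCo-+ x y k = trans (sumF-cong (λ j → ℤP.*-distribʳ-+ (A k j) (x j) (y j)))
                         (sumF-+ (λ j → x j * A k j) (λ j → y j * A k j))

  pairCo-* : ∀ c x k → pairCo D (λ j → c * x j) k ≡ c * pairCo D x k
  pairCo-* c x k = trans (sumF-cong (λ j → ℤP.*-assoc c (x j) (A k j))) (sumF-*ˡ c (λ j → x j * A k j))

  pairCo-minus : ∀ x y k → pairCo D (λ j → x j - y j) k ≡ pairCo D x k - pairCo D y k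
  pairCo-minus x y k = trans (sumF-cong (λ j → distrib (x j) (y j) (A k j)))
                         (sumF-minus (λ j → x j * A k j) (λ j → y j * A k j))
    where distrib : ∀ a b c → (a - b) * c ≡ a * c - b * c
          distrib = solve-∀

  pairCo-minus-* : ∀ x c y k → pairCo D (λ j → x j - c * y j) k ≡ pairCo D x k - c * pairCo D y k
  pairCo-minus-* x c y k = trans (pairCo-minus x (λ j → c * y j) k) (cong (λ z → pairCo D x k - z) (pairCo-* c y k))

  pairCo-form-swap : ∀ x y i → pairCo D x i * form D (e i) y ≡ pairCo D y i * form D x (e i)
  pairCo-form-swap x y i = *-cancelʳ-≡-pos _ _ (B-diag-pos i) (begin
    pairCo D x i * form D (e i) y * B i i ≡⟨ swap (pairCo D x i) _ (B i i) ⟩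
    pairCo D x i * B i i * form D (e i) y ≡⟨ cong (_* form D (e i) y) (pairCo-cartan x i) ⟩
    + 2 * form D x (e i) * form D (e i) y ≡⟨ cong (λ z → + 2 * form D x (e i) * z) (form-sym (e i) y) ⟩
    + 2 * form D x (e i) * form D y (e i) ≡⟨ swap′ (form D x (e i)) (form D y (e i)) ⟩
    + 2 * form D y (e i) * form D x (e i) ≡⟨ cong (_* form D x (e i)) (sym (pairCo-cartan y i)) ⟩
    pairCo D y i * B i i * form D x (e i) ≡⟨ swap (pairCo D y i) (B i i) _ ⟩
    pairCo D y i * form D x (e i) * B i i ∎)
    where
    open ≡-Reasoning
    swap : ∀ a b c → a * b * c ≡ a * c * b
    swap = solve-∀
    swap′ : ∀ a b → + 2 * a * b ≡ + 2 * b * a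
    swap′ = solve-∀

  sref-cong : ∀ i {x y} → x ≋ y → sref D i x ≋ sref D i y
  sref-cong i x≋y j = cong₂ (λ a b → a - b * e i j) (x≋y j) (pairCo-cong x≋y i)

  sref-off : ∀ i x j → i ≢ j → sref D i x j ≡ x j
  sref-off i x j i≢j = begin
    x j - pairCo D x i * e i j ≡⟨ cong (λ z → x j - pairCo D x i * z) (e-off i j i≢j) ⟩
    x j - pairCo D x i * 0ℤ    ≡⟨ cong (λ z → x j - z) (ℤP.*-zeroʳ (pairCo D x i)) ⟩
    x j - 0ℤ                   ≡⟨ ℤP.+-identityʳ (x j) ⟩
    x j                        ∎
    where open ≡-Reasoning

  sref-e-self : ∀ i → sref D i (e i) ≋ (λ j → - e i j)
  sref-e-self i j rewrite pairCo-e i i | A-diag i = reflect (e i j)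
    where reflect : ∀ a → a - + 2 * a ≡ - a
          reflect = solve-∀

  sref-e-self-at : ∀ i → sref D i (e i) i ≡ -1ℤ
  sref-e-self-at i = trans (sref-e-self i i) (cong -_ (e-diag i))

  pairCo-sref-self : ∀ i x → pairCo D (sref D i x) i ≡ - pairCo D x i
  pairCo-sref-self i x = begin
    pairCo D (sref D i x) i                        ≡⟨ pairCo-minus-* x (pairCo D x i) (e i) i ⟩
    pairCo D x i - pairCo D x i * pairCo D (e i) i ≡⟨ cong (λ z → pairCo D x i - pairCo D x i * z) (trans (pairCo-e i i) (A-diag i)) ⟩
    pairCo D x i - pairCo D x i * + 2              ≡⟨ reflect (pairCo D x i) ⟩
    - pairCo D x i                                 ∎
    where
    open ≡-Reasoning
    reflect : ∀ a → a - a * + 2 ≡ - a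
    reflect = solve-∀

  sref-involutive : ∀ i x → sref D i (sref D i x) ≋ x
  sref-involutive i x j rewrite pairCo-sref-self i x = cancel (x j) (pairCo D x i) (e i j)
    where cancel : ∀ a p q → a - p * q - - p * q ≡ a
          cancel = solve-∀

  sref-injective : ∀ i {x y} → sref D i x ≋ sref D i y → x ≋ y
  sref-injective i {x} {y} h j =
    trans (sym (sref-involutive i x j)) (trans (sref-cong i h j) (sref-involutive i y j))

  form-sref-e : ∀ i y → form D (e i) (sref D i y) ≡ - form D (e i) y
  form-sref-e i y = begin
    form D (e i) (sref D i y)                          ≡⟨ form-minus-*ʳ (e i) y (pairCo D y i) (e i) ⟩
    form D (e i) y - pairCo D y i * form D (e i) (e i) ≡⟨ cong (λ z → form D (e i) y - pairCo D y i * z) (form-ee i i) ⟩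
    form D (e i) y - pairCo D y i * B i i              ≡⟨ cong (λ z → form D (e i) y - z) (pairCo-cartan y i) ⟩
    form D (e i) y - + 2 * form D y (e i)              ≡⟨ cong (λ z → form D (e i) y - + 2 * z) (form-sym y (e i)) ⟩
    form D (e i) y - + 2 * form D (e i) y              ≡⟨ reflect (form D (e i) y) ⟩
    - form D (e i) y                                   ∎
    where
    open ≡-Reasoning
    reflect : ∀ a → a - + 2 * a ≡ - a
    reflect = solve-∀

  form-sref : ∀ i x y → form D (sref D i x) (sref D i y) ≡ form D x y
  form-sref i x y = begin
    form D (sref D i x) (sref D i y)
      ≡⟨ form-minus-*ˡ x a (e i) (sref D i y) ⟩
    form D x (sref D i y) - a * form D (e i) (sref D i y)
      ≡⟨ cong₂ (λ u v → u - a * v) (form-minus-*ʳ x y b (e i)) (form-sref-e i y) ⟩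
    form D x y - b * form D x (e i) - a * - form D (e i) y
      ≡⟨ cong (λ z → form D x y - b * form D x (e i) - z) (sym (ℤP.neg-distribʳ-* a _)) ⟩
    form D x y - b * form D x (e i) - - (a * form D (e i) y)
      ≡⟨ cong (λ z → form D x y - b * form D x (e i) - - z) (pairCo-form-swap x y i) ⟩
    form D x y - b * form D x (e i) - - (b * form D x (e i))
      ≡⟨ cancel (form D x y) (b * form D x (e i)) ⟩
    form D x y
      ∎
    where
    open ≡-Reasoning
    a b : ℤ
    a = pairCo D x i
    b = pairCo D y i
    cancel : ∀ u v → u - v - - v ≡ u
    cancel = solve-∀

  form-sref-adjoint : ∀ i x y → form D (sref D i x) y ≡ form D x (sref D i y)
  form-sref-adjoint i x y = trans (form-cong {sref D i x} ≋-refl (≋-sym (sref-involutive i y)))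
                                  (form-sref i x (sref D i y))

  sref-minus-* : ∀ i x c y → sref D i (λ j → x j - c * y j) ≋ (λ j → sref D i x j - c * sref D i y j)
  sref-minus-* i x c y j rewrite pairCo-minus-* x c y i = distrib c (x j) (y j) (pairCo D x i) (pairCo D y i) (e i j)
    where distrib : ∀ c a b p q E → a - c * b - (p - c * q) * E ≡ a - p * E - c * (b - q * E)
          distrib = solve-∀

  sref-* : ∀ i c x → sref D i (λ j → c * x j) ≋ (λ j → c * sref D i x j)
  sref-* i c x j rewrite pairCo-* c x i = distrib c (x j) (pairCo D x i) (e i j)
    where distrib : ∀ c a p E → c * a - c * p * E ≡ c * (a - p * E)
          distrib = solve-∀

  sref-+ : ∀ i x y → sref D i (λ j → x j + y j) ≋ (λ j → sref D i x j + sref D i y j)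
  sref-+ i x y j rewrite pairCo-+ x y i = distrib (x j) (y j) (pairCo D x i) (pairCo D y i) (e i j)
    where distrib : ∀ a b p q E → a + b - (p + q) * E ≡ (a - p * E) + (b - q * E)
          distrib = solve-∀

  sref-neg : ∀ i x → sref D i (λ j → - x j) ≋ (λ j → - sref D i x j)
  sref-neg i x j = trans (sref-cong i (λ k → sym (ℤP.-1*i≡-i (x k))) j)
                         (trans (sref-* i -1ℤ x j) (ℤP.-1*i≡-i (sref D i x j)))

  act-cong : ∀ w {x y} → x ≋ y → act D w x ≋ act D w y
  act-cong []      x≋y = x≋y
  act-cong (i ∷ w) x≋y = sref-cong i (act-cong w x≋y)

  act-++ : ∀ u v x → act D (u ++ v) x ≋ act D u (act D v x)
  act-++ []      v x = ≋-refl
  act-++ (i ∷ u) v x = sref-cong i (act-++ u v x)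

  act-+ : ∀ w x y → act D w (λ j → x j + y j) ≋ (λ j → act D w x j + act D w y j)
  act-+ []      x y = ≋-refl
  act-+ (i ∷ w) x y = ≋-trans (sref-cong i (act-+ w x y)) (sref-+ i (act D w x) (act D w y))

  act-neg : ∀ w x → act D w (λ j → - x j) ≋ (λ j → - act D w x j)
  act-neg []      x = ≋-refl
  act-neg (i ∷ w) x = ≋-trans (sref-cong i (act-neg w x)) (sref-neg i (act D w x))

  act-reverse : ∀ w x → act D (reverse w) (act D w x) ≋ x
  act-reverse []      x = ≋-refl
  act-reverse (i ∷ w) x j = begin
    act D (reverse (i ∷ w)) (sref D i (act D w x)) j      ≡⟨ cong (λ u → act D u (sref D i (act D w x)) j) (LP.unfold-reverse i w) ⟩
    act D (reverse w ++ i ∷ []) (sref D i (act D w x)) j  ≡⟨ act-++ (reverse w) (i ∷ []) (sref D i (act D w x)) j ⟩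
    act D (reverse w) (sref D i (sref D i (act D w x))) j ≡⟨ act-cong (reverse w) (sref-involutive i (act D w x)) j ⟩
    act D (reverse w) (act D w x) j                       ≡⟨ act-reverse w x j ⟩
    x j                                                   ∎
    where open ≡-Reasoning

  act-injective : ∀ w {x y} → act D w x ≋ act D w y → x ≋ y
  act-injective w {x} {y} h j =
    trans (sym (act-reverse w x j)) (trans (act-cong (reverse w) h j) (act-reverse w y j))

  form-act : ∀ w x y → form D (act D w x) (act D w y) ≡ form D x y
  form-act []      x y = refl
  form-act (i ∷ w) x y = trans (form-sref i (act D w x) (act D w y)) (form-act w x y)

  IsRoot-e : ∀ i → IsRoot D (e i)
  IsRoot-e i = [] , i , ≋-refl

  IsRoot-cong : ∀ {x y} → x ≋ y → IsRoot D x → IsRoot D y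
  IsRoot-cong x≋y (w , i , x≋) = w , i , ≋-trans (≋-sym x≋y) x≋

  IsRoot-act : ∀ w {x} → IsRoot D x → IsRoot D (act D w x)
  IsRoot-act w (v , i , x≋) = w ++ v , i , ≋-trans (act-cong w x≋) (≋-sym (act-++ w v (e i)))

  IsRoot-sref : ∀ i {x} → IsRoot D x → IsRoot D (sref D i x)
  IsRoot-sref i = IsRoot-act (i ∷ [])

  IsRoot-neg : ∀ {x} → IsRoot D x → IsRoot D (λ j → - x j)
  IsRoot-neg {x} (w , i , x≋) = w ++ i ∷ [] , i , λ j → begin
    - x j                       ≡⟨ cong -_ (x≋ j) ⟩
    - act D w (e i) j           ≡⟨ act-neg w (e i) j ⟨
    act D w (λ k → - e i k) j   ≡⟨ act-cong w (sref-e-self i) j ⟨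
    act D w (sref D i (e i)) j  ≡⟨ act-++ w (i ∷ []) (e i) j ⟨
    act D (w ++ i ∷ []) (e i) j ∎
    where open ≡-Reasoning

  IsRoot-norm-pos : ∀ {x} → IsRoot D x → 0ℤ < form D x x
  IsRoot-norm-pos {x} (w , i , x≋) = subst (0ℤ <_) (sym norm) (B-diag-pos i)
    where
    norm : form D x x ≡ B i i
    norm = trans (form-cong x≋ x≋) (trans (form-act w (e i) (e i)) (form-ee i i))

  pairCoroot : Vect l → Fin l → ℤ
  pairCoroot m i = sumF (λ k → m k * A k i)

  pairCoroot-form : ∀ {α m} → CorootCoeffs D α m → ∀ i →
    pairCoroot m i * form D α α ≡ + 2 * form D α (e i)
  pairCoroot-form {α} {m} coeffs i = begin
    sumF (λ k → m k * A k i) * N     ≡⟨ sumF-*ʳ N (λ k → m k * A k i) ⟨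
    sumF (λ k → m k * A k i * N)     ≡⟨ sumF-cong step ⟩
    sumF (λ k → + 2 * (B i k * α k)) ≡⟨ sumF-*ˡ (+ 2) (λ k → B i k * α k) ⟩
    + 2 * sumF (λ k → B i k * α k)   ≡⟨ cong (+ 2 *_) (form-e i α) ⟨
    + 2 * form D (e i) α             ≡⟨ cong (+ 2 *_) (form-sym (e i) α) ⟩
    + 2 * form D α (e i)             ∎
    where
    open ≡-Reasoning
    N : ℤ
    N = form D α α
    step : ∀ k → m k * A k i * N ≡ + 2 * (B i k * α k)
    step k = begin
      m k * A k i * N       ≡⟨ swap (m k) (A k i) N ⟩
      (m k * N) * A k i     ≡⟨ cong (_* A k i) (coeffs k) ⟩
      α k * B k k * A k i   ≡⟨ ℤP.*-assoc (α k) (B k k) (A k i) ⟩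
      α k * (B k k * A k i) ≡⟨ cong (α k *_) (trans (cartan k i) (cong (+ 2 *_) (B-sym k i))) ⟩
      α k * (+ 2 * B i k)   ≡⟨ swap′ (α k) (B i k) ⟩
      + 2 * (B i k * α k)   ∎
      where
      swap : ∀ a b c → a * b * c ≡ (a * c) * b
      swap = solve-∀
      swap′ : ∀ a b → a * (+ 2 * b) ≡ + 2 * (b * a)
      swap′ = solve-∀

  CorootCoeffs-cong : ∀ {α β m m′} → α ≋ β → m ≋ m′ → CorootCoeffs D α m → CorootCoeffs D β m′
  CorootCoeffs-cong α≋β m≋m′ coeffs k =
    trans (cong₂ _*_ (sym (m≋m′ k)) (form-cong (≋-sym α≋β) (≋-sym α≋β)))
          (trans (coeffs k) (cong (_* B k k) (α≋β k)))

  CorootCoeffs-e : ∀ i → CorootCoeffs D (e i) (e i)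
  CorootCoeffs-e i k = trans (cong (e i k *_) (form-ee i i)) (e-*-cong i k (λ { refl → refl }))

  -- The reflected coroot is s_i(α^∨) = α^∨ - ⟨α_i , α^∨⟩ α_i^∨.
  CorootCoeffs-sref : ∀ i {α m} → CorootCoeffs D α m →
    CorootCoeffs D (sref D i α) (λ k → m k - pairCoroot m i * e i k)
  CorootCoeffs-sref i {α} {m} coeffs k = begin
    (m k - n * e i k) * form D (sref D i α) (sref D i α) ≡⟨ cong ((m k - n * e i k) *_) (form-sref i α α) ⟩
    (m k - n * e i k) * N                                ≡⟨ expand (m k) n (e i k) N ⟩
    m k * N - e i k * (n * N)                            ≡⟨ cong₂ (λ x y → x - e i k * y) (coeffs k) (pairCoroot-form {α} {m} coeffs i) ⟩
    α k * B k k - e i k * (+ 2 * form D α (e i))         ≡⟨ cong (λ z → α k * B k k - z) (e-*-cong i k (λ { refl → sym (pairCo-cartan α i) })) ⟩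
    α k * B k k - e i k * (pairCo D α i * B k k)         ≡⟨ collect (α k) (pairCo D α i) (e i k) (B k k) ⟩
    (α k - pairCo D α i * e i k) * B k k                 ∎
    where
    open ≡-Reasoning
    n N : ℤ
    n = pairCoroot m i
    N = form D α α
    expand : ∀ a n E N → (a - n * E) * N ≡ a * N - E * (n * N)
    expand = solve-∀
    collect : ∀ a c E B → a * B - E * (c * B) ≡ (a - c * E) * B
    collect = solve-∀

  IsRoot⇒CorootCoeffs : ∀ {α} → IsRoot D α → ∃ λ m → CorootCoeffs D α m
  IsRoot⇒CorootCoeffs (w , i , α≋) = let (m , coeffs) = orbit w in
    m , CorootCoeffs-cong {m = m} (≋-sym α≋) ≋-refl coeffs
    where
    orbit : ∀ w → ∃ λ m → CorootCoeffs D (act D w (e i)) m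
    orbit []      = e i , CorootCoeffs-e i
    orbit (j ∷ w) = let (m , coeffs) = orbit w in (λ k → m k - pairCoroot m j * e j k) , CorootCoeffs-sref j {act D w (e i)} {m} coeffs

  supported-at⇒±1 : ∀ {β} i → IsRoot D β → (∀ j → i ≢ j → β j ≡ 0ℤ) → β i ≡ 1ℤ ⊎ β i ≡ -1ℤ
  supported-at⇒±1 {β} i root off = i*j≡1⇒j≡±1 (m i) (β i) mβ≡1
    where
    m : Vect l
    m = proj₁ (IsRoot⇒CorootCoeffs root)
    β≋ : β ≋ (λ j → β i * e i j)
    β≋ = supported-at⇒≋*e i off
    N≡ : form D β β ≡ β i * (β i * B i i)
    N≡ = trans (form-cong β≋ β≋) (trans (form-*ˡ (β i) (e i) (λ j → β i * e i j))
           (cong (β i *_) (trans (form-*ʳ (β i) (e i) (e i)) (cong (β i *_) (form-ee i i)))))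
    βB≢0 : β i * B i i ≢ 0ℤ
    βB≢0 eq = ℤP.<-irrefl refl (subst (0ℤ <_) (trans N≡ (trans (cong (β i *_) eq) (ℤP.*-zeroʳ (β i))))
                                      (IsRoot-norm-pos root))
    mβ≡1 : m i * β i ≡ 1ℤ
    mβ≡1 = ℤP.*-cancelʳ-≡ (m i * β i) 1ℤ (β i * B i i) {{ℤ.≢-nonZero βB≢0}} (begin
      m i * β i * (β i * B i i)   ≡⟨ ℤP.*-assoc (m i) (β i) _ ⟩
      m i * (β i * (β i * B i i)) ≡⟨ cong (m i *_) N≡ ⟨
      m i * form D β β            ≡⟨ proj₂ (IsRoot⇒CorootCoeffs root) i ⟩
      β i * B i i                 ≡⟨ ℤP.*-identityˡ (β i * B i i) ⟨
      1ℤ * (β i * B i i)          ∎)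
      where open ≡-Reasoning

  supported-at⇒±e : ∀ {β} i → IsRoot D β → (∀ j → i ≢ j → β j ≡ 0ℤ) →
    β ≋ e i ⊎ β ≋ (λ j → - e i j)
  supported-at⇒±e {β} i root off =
    [ (λ βi≡1 → inj₁ λ j → trans (β≋ j) (trans (cong (_* e i j) βi≡1) (ℤP.*-identityˡ (e i j))))
    , (λ βi≡-1 → inj₂ λ j → trans (β≋ j) (trans (cong (_* e i j) βi≡-1) (ℤP.-1*i≡-i (e i j)))) ]′
    (supported-at⇒±1 i root off)
    where
    β≋ : β ≋ (λ j → β i * e i j)
    β≋ = supported-at⇒≋*e i off

  -- Every root is positive or negative

  row-nonPos : ∀ {Q} i → AllNonNeg Q → Q i ≡ 0ℤ → form D (e i) Q ≤ 0ℤ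
  row-nonPos {Q} i Q≥0 Qi≡0 = subst (_≤ 0ℤ) (sym (form-e i Q)) (sumF-nonPos (λ j → B i j * Q j) term≤0)
    where
    term≤0 : ∀ j → B i j * Q j ≤ 0ℤ
    term≤0 j with i ≟ j
    ... | yes refl = ℤP.≤-reflexive (trans (cong (B i i *_) Qi≡0) (ℤP.*-zeroʳ (B i i)))
    ... | no i≢j  = subst (_≤ 0ℤ) (ℤP.*-comm (Q j) (B i j)) (i*j≤0 (Q≥0 j) (B-off-nonPos i j i≢j))

  posMass : Vect l → ℤ
  posMass δ = sumF (λ k → pos-part (δ k))

  -- Write δ = P - Q with P, Q ≥ 0 of disjoint supports.  Integrality gives P(δ^∨) = 1, i.e.
  -- ⟨δ , δ⟩ = 2⟨P , P⟩ - 2⟨P , Q⟩; comparing with ⟨2P - t α_j₀ , 2P - t α_j₀⟩ ≥ 0 leaves only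
  -- ⟨δ , α_j₀^∨⟩ = 1 for a suitable j₀ in the support of P.  Then s_j₀ δ = δ - α_j₀ is again
  -- mixed, with smaller positive mass.
  module MixedRoot {δ : Vect l} (root : IsRoot D δ) (pos : SomePos δ) (neg : SomeNeg δ) where

    P Q : Vect l
    P k = pos-part (δ k)
    Q k = neg-part (δ k)

    δ≋P-Q : δ ≋ (λ k → P k - Q k)
    δ≋P-Q k = pos-part-neg-part (δ k)

    N : ℤ
    N = form D δ δ

    m : Vect l
    m = proj₁ (IsRoot⇒CorootCoeffs root)

    onCoroot : Vect l → ℤ
    onCoroot x = sumF (λ k → x k * pairCoroot m k)

    onCoroot-form : ∀ x → onCoroot x * N ≡ + 2 * form D x δ
    onCoroot-form x = begin
      onCoroot x * N                            ≡⟨ sumF-*ʳ N (λ k → x k * pairCoroot m k) ⟨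
      sumF (λ k → x k * pairCoroot m k * N)     ≡⟨ sumF-cong term ⟩
      sumF (λ k → + 2 * (x k * form D (e k) δ)) ≡⟨ sumF-*ˡ (+ 2) (λ k → x k * form D (e k) δ) ⟩
      + 2 * sumF (λ k → x k * form D (e k) δ)   ≡⟨ cong (+ 2 *_) (form-expand x δ) ⟨
      + 2 * form D x δ                          ∎
      where
      open ≡-Reasoning
      swap : ∀ a b → a * (+ 2 * b) ≡ + 2 * (a * b)
      swap = solve-∀
      term : ∀ k → x k * pairCoroot m k * N ≡ + 2 * (x k * form D (e k) δ)
      term k = trans (ℤP.*-assoc (x k) _ N)
        (trans (cong (x k *_) (trans (pairCoroot-form {δ} {m} (proj₂ (IsRoot⇒CorootCoeffs root)) k)
                                     (cong (+ 2 *_) (form-sym δ (e k)))))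
               (swap (x k) (form D (e k) δ)))

    P*Q-term≤0 : ∀ k → P k * form D (e k) Q ≤ 0ℤ
    P*Q-term≤0 k with 0ℤ ℤP.<? P k
    ... | yes 0<Pk = i*j≤0 (pos-part-nonNeg (δ k))
                       (row-nonPos k (λ j → neg-part-nonNeg (δ j)) (0<pos-part⇒neg-part≡0 0<Pk))
    ... | no 0≮Pk  rewrite ℤP.≤-antisym (ℤP.≮⇒≥ 0≮Pk) (pos-part-nonNeg (δ k)) = ℤP.≤-refl

    PQ≤0 : form D P Q ≤ 0ℤ
    PQ≤0 = subst (_≤ 0ℤ) (sym (form-expand P Q)) (sumF-nonPos _ P*Q-term≤0)

    form-Pδ : form D P δ ≡ form D P P - form D P Q
    form-Pδ = trans (form-cong {P} ≋-refl δ≋P-Q) (form-minusʳ P P Q)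

    form-Qδ : form D Q δ ≡ form D Q P - form D Q Q
    form-Qδ = trans (form-cong {Q} ≋-refl δ≋P-Q) (form-minusʳ Q P Q)

    0<PP : 0ℤ < form D P P
    0<PP = let (j , 0<δj) = pos in
      B-posdef P (j , λ Pj≡0 → ℤP.<-irrefl (sym Pj≡0) (subst (0ℤ <_) (sym (0<⇒pos-part≡ 0<δj)) 0<δj))

    0<QQ : 0ℤ < form D Q Q
    0<QQ = let (j , δj<0) = neg in
      B-posdef Q (j , λ Qj≡0 → ℤP.<-irrefl (sym Qj≡0) (<0⇒0<neg-part δj<0))

    onCoroot-P≡1 : onCoroot P ≡ 1ℤ
    onCoroot-P≡1 = i-j≡2⇒i≡1 P-Q≡2 0<P (i*k<0⇒i<0 0<N Q<0)
      where
      0<N : 0ℤ < N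
      0<N = IsRoot-norm-pos root
      P-Q≡2 : onCoroot P - onCoroot Q ≡ + 2
      P-Q≡2 = *-cancelʳ-≡-pos _ _ 0<N (begin
        (onCoroot P - onCoroot Q) * N       ≡⟨ distrib (onCoroot P) (onCoroot Q) N ⟩
        onCoroot P * N - onCoroot Q * N     ≡⟨ cong₂ _-_ (onCoroot-form P) (onCoroot-form Q) ⟩
        + 2 * form D P δ - + 2 * form D Q δ ≡⟨ factor (form D P δ) (form D Q δ) ⟩
        + 2 * (form D P δ - form D Q δ)     ≡⟨ cong (+ 2 *_) (form-minusˡ P Q δ) ⟨
        + 2 * form D (λ k → P k - Q k) δ    ≡⟨ cong (+ 2 *_) (form-cong (≋-sym δ≋P-Q) ≋-refl) ⟩
        + 2 * N                             ∎)
        where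
        open ≡-Reasoning
        distrib : ∀ a b n → (a - b) * n ≡ a * n - b * n
        distrib = solve-∀
        factor : ∀ x y → + 2 * x - + 2 * y ≡ + 2 * (x - y)
        factor = solve-∀
      0<P : 0ℤ < onCoroot P
      0<P = 0<i*k⇒0<i 0<N (subst (0ℤ <_) (sym (trans (onCoroot-form P) (cong (+ 2 *_) form-Pδ)))
              (0<i*j {+ 2} (ℤ.+<+ (s≤s z≤n)) (ℤP.<-≤-trans 0<PP (ℤP.≤-trans (ℤP.≤-reflexive (sym (ℤP.+-identityʳ _)))
                                                                      (ℤP.+-monoʳ-≤ (form D P P) (ℤP.neg-mono-≤ PQ≤0))))))
      Q<0 : onCoroot Q * N < 0ℤ
      Q<0 = subst (_< 0ℤ) (sym (trans (onCoroot-form Q) (cong (+ 2 *_) form-Qδ)))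
              (ℤP.*-monoˡ-<-pos (+ 2) (ℤP.≤-<-trans (ℤP.+-monoˡ-≤ (- form D Q Q) (subst (_≤ 0ℤ) (form-sym P Q) PQ≤0))
                                                    (subst (_< 0ℤ) (sym (ℤP.+-identityˡ _)) (ℤP.neg-mono-< 0<QQ))))

    N≡ : N ≡ + 2 * form D P P - + 2 * form D P Q
    N≡ = begin
      N                                   ≡⟨ ℤP.*-identityˡ N ⟨
      1ℤ * N                              ≡⟨ cong (_* N) onCoroot-P≡1 ⟨
      onCoroot P * N                      ≡⟨ onCoroot-form P ⟩
      + 2 * form D P δ                    ≡⟨ cong (+ 2 *_) form-Pδ ⟩
      + 2 * (form D P P - form D P Q)     ≡⟨ distrib (form D P P) (form D P Q) ⟩
      + 2 * form D P P - + 2 * form D P Q ∎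
      where
      open ≡-Reasoning
      distrib : ∀ x y → + 2 * (x - y) ≡ + 2 * x - + 2 * y
      distrib = solve-∀

    simple-direction : ∃ λ j → 0ℤ < P j × 0ℤ < form D (e j) P
    simple-direction = positive-direction (λ k → pos-part-nonNeg (δ k)) 0<PP

    j₀ : Fin l
    j₀ = proj₁ simple-direction

    p t u c n B₀ : ℤ
    p  = P j₀
    t  = pairCo D P j₀
    u  = - pairCo D Q j₀
    c  = pairCo D δ j₀
    n  = pairCoroot m j₀
    B₀ = B j₀ j₀

    0<p : 0ℤ < p
    0<p = proj₁ (proj₂ simple-direction)

    δj₀≡p : δ j₀ ≡ p
    δj₀≡p = sym (0<⇒pos-part≡ (0<pos-part⇒0< 0<p))

    0<B₀ : 0ℤ < B₀
    0<B₀ = B-diag-pos j₀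

    0<t : 0ℤ < t
    0<t = 0<i*k⇒0<i 0<B₀ (subst (0ℤ <_) (sym (trans (pairCo-cartan P j₀) (cong (+ 2 *_) (form-sym P (e j₀)))))
                                 (0<i*j {+ 2} (ℤ.+<+ (s≤s z≤n)) (proj₂ (proj₂ simple-direction))))

    Qe≤0 : form D Q (e j₀) ≤ 0ℤ
    Qe≤0 = subst (_≤ 0ℤ) (form-sym (e j₀) Q)
             (row-nonPos j₀ (λ j → neg-part-nonNeg (δ j)) (0<pos-part⇒neg-part≡0 0<p))

    uB₀≡ : u * B₀ ≡ - (+ 2 * form D Q (e j₀))
    uB₀≡ = trans (sym (ℤP.neg-distribˡ-* (pairCo D Q j₀) B₀)) (cong -_ (pairCo-cartan Q j₀))

    0≤u : 0ℤ ≤ u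
    0≤u = 0≤i*k⇒0≤i 0<B₀ (subst (0ℤ ≤_) (sym uB₀≡) (ℤP.neg-mono-≤ (i*j≤0 {+ 2} (ℤ.+≤+ z≤n) Qe≤0)))

    c≡t+u : c ≡ t + u
    c≡t+u = trans (pairCo-cong δ≋P-Q j₀) (pairCo-minus P Q j₀)

    t≤c : t ≤ c
    t≤c = subst (t ≤_) (sym c≡t+u) (ℤP.≤-trans (ℤP.≤-reflexive (sym (ℤP.+-identityʳ t))) (ℤP.+-monoʳ-≤ t 0≤u))

    nN≡cB₀ : n * N ≡ c * B₀
    nN≡cB₀ = trans (pairCoroot-form {δ} {m} (proj₂ (IsRoot⇒CorootCoeffs root)) j₀) (sym (pairCo-cartan δ j₀))

    0<n : 0ℤ < n
    0<n = 0<i*k⇒0<i (IsRoot-norm-pos root) (subst (0ℤ <_) (sym nN≡cB₀) (0<i*j (ℤP.<-≤-trans 0<t t≤c) 0<B₀))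

    PQ≤pQe : form D P Q ≤ p * form D Q (e j₀)
    PQ≤pQe = ℤP.≤-trans (ℤP.≤-reflexive (form-expand P Q))
               (ℤP.≤-trans (sumF≤term _ P*Q-term≤0 j₀) (ℤP.≤-reflexive (cong (p *_) (form-sym (e j₀) Q))))

    4PP+2puB₀≤2N : + 4 * form D P P + + 2 * p * u * B₀ ≤ + 2 * N
    4PP+2puB₀≤2N = begin
      + 4 * PP + + 2 * p * u * B₀       ≡⟨ assoc (+ 4 * PP) p u B₀ ⟩
      + 4 * PP + + 2 * p * (u * B₀)     ≡⟨ cong (λ z → + 4 * PP + + 2 * p * z) uB₀≡ ⟩
      + 4 * PP + + 2 * p * - (+ 2 * Qe) ≡⟨ expand PP p Qe ⟩
      + 2 * (+ 2 * PP - + 2 * (p * Qe)) ≤⟨ ℤP.*-monoˡ-≤-nonNeg (+ 2) (ℤP.+-monoʳ-≤ (+ 2 * PP)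
                                                     (ℤP.neg-mono-≤ (ℤP.*-monoˡ-≤-nonNeg (+ 2) PQ≤pQe))) ⟩
      + 2 * (+ 2 * PP - + 2 * form D P Q) ≡⟨ cong (+ 2 *_) N≡ ⟨
      + 2 * N                             ∎
      where
      open ℤP.≤-Reasoning
      PP Qe : ℤ
      PP = form D P P
      Qe = form D Q (e j₀)
      assoc : ∀ a p u b → a + + 2 * p * u * b ≡ a + + 2 * p * (u * b)
      assoc = solve-∀
      expand : ∀ PP p Qe → + 4 * PP + + 2 * p * - (+ 2 * Qe) ≡ + 2 * (+ 2 * PP - + 2 * (p * Qe))
      expand = solve-∀

    descent-bound : ∀ a → a ≤ + 4 * form D P P → n * (a + + 2 * p * u * B₀) ≤ (+ 2 * t + + 2 * u) * B₀
    descent-bound a a≤4PP = begin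
      n * (a + + 2 * p * u * B₀)     ≤⟨ ℤP.*-monoˡ-≤-nonNeg n {{ℤ.nonNegative (ℤP.<⇒≤ 0<n)}}
                                          (ℤP.≤-trans (ℤP.+-monoˡ-≤ _ a≤4PP) 4PP+2puB₀≤2N) ⟩
      n * (+ 2 * N)            ≡⟨ swap n N ⟩
      + 2 * (n * N)            ≡⟨ cong (+ 2 *_) nN≡cB₀ ⟩
      + 2 * (c * B₀)           ≡⟨ cong (λ z → + 2 * (z * B₀)) c≡t+u ⟩
      + 2 * ((t + u) * B₀)     ≡⟨ distrib t u B₀ ⟩
      (+ 2 * t + + 2 * u) * B₀ ∎
      where
      open ℤP.≤-Reasoning
      swap : ∀ n N → n * (+ 2 * N) ≡ + 2 * (n * N)
      swap = solve-∀
      distrib : ∀ t u B → + 2 * ((t + u) * B) ≡ (+ 2 * t + + 2 * u) * B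
      distrib = solve-∀

    descent-bound-weak : t * t * B₀ ≤ + 4 * form D P P → n * t * t + + 2 * n * p * u ≤ + 2 * t + + 2 * u
    descent-bound-weak ttB₀≤4PP = ℤP.*-cancelʳ-≤-pos _ _ B₀ {{ℤ.positive 0<B₀}}
      (subst (_≤ (+ 2 * t + + 2 * u) * B₀) (regroup n t p u B₀) (descent-bound (t * t * B₀) ttB₀≤4PP))
      where regroup : ∀ n t p u B → n * (t * t * B + + 2 * p * u * B) ≡ (n * t * t + + 2 * n * p * u) * B
            regroup = solve-∀

    descent-bound-strict : t * t * B₀ < + 4 * form D P P → n * t * t + + 2 * n * p * u < + 2 * t + + 2 * u
    descent-bound-strict ttB₀<4PP = ℤP.*-cancelʳ-<-nonNeg B₀ {{ℤ.nonNegative (ℤP.<⇒≤ 0<B₀)}} (begin-strict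
      (n * t * t + + 2 * n * p * u) * B₀       ≡⟨ ℤP.+-identityʳ ((n * t * t + + 2 * n * p * u) * B₀) ⟨
      (n * t * t + + 2 * n * p * u) * B₀ + 0ℤ  <⟨ ℤP.+-monoʳ-< ((n * t * t + + 2 * n * p * u) * B₀) 0<n ⟩
      (n * t * t + + 2 * n * p * u) * B₀ + n   ≡⟨ regroup n t p u B₀ ⟩
      n * (1ℤ + t * t * B₀ + + 2 * p * u * B₀) ≤⟨ descent-bound (1ℤ + t * t * B₀) (ℤP.i<j⇒suc[i]≤j ttB₀<4PP) ⟩
      (+ 2 * t + + 2 * u) * B₀                 ∎)
      where
      open ℤP.≤-Reasoning
      regroup : ∀ n t p u B → (n * t * t + + 2 * n * p * u) * B + n ≡ n * (1ℤ + t * t * B + + 2 * p * u * B)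
      regroup = solve-∀

    x : Vect l
    x k = + 2 * P k - t * e j₀ k

    form-x : form D x x ≡ + 4 * form D P P - t * t * B₀
    form-x = begin
      form D x x
        ≡⟨ form-minus-*ˡ (λ k → + 2 * P k) t (e j₀) x ⟩
      form D (λ k → + 2 * P k) x - t * form D (e j₀) x
        ≡⟨ cong₂ (λ a b → a - t * b) (form-*ˡ (+ 2) P x) (form-minus-*ʳ (e j₀) (λ k → + 2 * P k) t (e j₀)) ⟩
      + 2 * form D P x - t * (form D (e j₀) (λ k → + 2 * P k) - t * form D (e j₀) (e j₀))
        ≡⟨ cong₂ (λ a b → + 2 * a - t * b) (form-minus-*ʳ P (λ k → + 2 * P k) t (e j₀))
                 (cong₂ (λ a b → a - t * b) (form-*ʳ (+ 2) (e j₀) P) (form-ee j₀ j₀)) ⟩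
      + 2 * (form D P (λ k → + 2 * P k) - t * Pe) - t * (+ 2 * form D (e j₀) P - t * B₀)
        ≡⟨ cong₂ (λ a b → + 2 * (a - t * Pe) - t * (+ 2 * b - t * B₀)) (form-*ʳ (+ 2) P P) (form-sym (e j₀) P) ⟩
      + 2 * (+ 2 * PP - t * Pe) - t * (+ 2 * Pe - t * B₀)
        ≡⟨ regroup PP t Pe B₀ ⟩
      + 4 * PP - t * (+ 2 * Pe) - t * (+ 2 * Pe) + t * t * B₀
        ≡⟨ cong (λ z → + 4 * PP - t * z - t * z + t * t * B₀) (pairCo-cartan P j₀) ⟨
      + 4 * PP - t * (t * B₀) - t * (t * B₀) + t * t * B₀
        ≡⟨ collect PP t B₀ ⟩
      + 4 * PP - t * t * B₀
        ∎
      where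
      open ≡-Reasoning
      PP Pe : ℤ
      PP = form D P P
      Pe = form D P (e j₀)
      regroup : ∀ PP t Pe B → + 2 * (+ 2 * PP - t * Pe) - t * (+ 2 * Pe - t * B)
                              ≡ + 4 * PP - t * (+ 2 * Pe) - t * (+ 2 * Pe) + t * t * B
      regroup = solve-∀
      collect : ∀ PP t B → + 4 * PP - t * (t * B) - t * (t * B) + t * t * B ≡ + 4 * PP - t * t * B
      collect = solve-∀

    m-j₀*c≡p : n ≡ 1ℤ → m j₀ * c ≡ p
    m-j₀*c≡p n≡1 = *-cancelʳ-≡-pos _ _ 0<B₀ (begin
      m j₀ * c * B₀   ≡⟨ ℤP.*-assoc (m j₀) c B₀ ⟩
      m j₀ * (c * B₀) ≡⟨ cong (m j₀ *_) nN≡cB₀ ⟨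
      m j₀ * (n * N)  ≡⟨ cong (λ z → m j₀ * (z * N)) n≡1 ⟩
      m j₀ * (1ℤ * N) ≡⟨ cong (m j₀ *_) (ℤP.*-identityˡ N) ⟩
      m j₀ * N        ≡⟨ proj₂ (IsRoot⇒CorootCoeffs root) j₀ ⟩
      δ j₀ * B₀       ≡⟨ cong (_* B₀) δj₀≡p ⟩
      p * B₀          ∎)
      where open ≡-Reasoning

    c≡±1 : n ≡ 1ℤ → p ≡ 1ℤ → c ≡ 1ℤ ⊎ c ≡ -1ℤ
    c≡±1 n≡1 p≡1 = i*j≡1⇒j≡±1 (m j₀) c (trans (m-j₀*c≡p n≡1) p≡1)

    x≋0⇒t≡2p : x ≋ (λ _ → 0ℤ) → t ≡ + 2 * p
    x≋0⇒t≡2p x≋0 = begin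
      t                            ≡⟨ shift (+ 2 * p) t ⟩
      + 2 * p - (+ 2 * p - t * 1ℤ) ≡⟨ cong (λ z → + 2 * p - (+ 2 * p - t * z)) (e-diag j₀) ⟨
      + 2 * p - x j₀               ≡⟨ cong (λ z → + 2 * p - z) (x≋0 j₀) ⟩
      + 2 * p - 0ℤ                 ≡⟨ ℤP.+-identityʳ (+ 2 * p) ⟩
      + 2 * p                      ∎
      where
      open ≡-Reasoning
      shift : ∀ a b → b ≡ a - (a - b * 1ℤ)
      shift = solve-∀

    x≋0⇒ttB₀≡4PP : x ≋ (λ _ → 0ℤ) → t * t * B₀ ≡ + 4 * form D P P
    x≋0⇒ttB₀≡4PP x≋0 = begin
      t * t * B₀      ≡⟨ ℤP.+-identityʳ (t * t * B₀) ⟨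
      t * t * B₀ + 0ℤ ≡⟨ cong (λ z → t * t * B₀ + z)
                                                        (trans (sym (form-zeroˡ (λ _ → 0ℤ))) (form-cong (≋-sym x≋0) (≋-sym x≋0))) ⟩
      t * t * B₀ + form D x x                      ≡⟨ cong (λ z → t * t * B₀ + z) form-x ⟩
      t * t * B₀ + (+ 4 * form D P P - t * t * B₀) ≡⟨ cancel (t * t * B₀) (+ 4 * form D P P) ⟩
      + 4 * form D P P                             ∎
      where
      open ≡-Reasoning
      cancel : ∀ a b → a + (b - a) ≡ b
      cancel = solve-∀

    x≋0⇒⊥ : x ≋ (λ _ → 0ℤ) → ⊥
    x≋0⇒⊥ x≋0 = [ (λ c≡1 → ℤP.<⇒≱ (ℤ.+<+ (s≤s (s≤s z≤n))) (subst (+ 2 ≤_) c≡1 2≤c))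
                , (λ c≡-1 → ℤP.<⇒≱ ℤ.-<+ (subst (+ 2 ≤_) c≡-1 2≤c)) ]′ (c≡±1 n≡1 p≡1)
      where
      t≡2p : t ≡ + 2 * p
      t≡2p = x≋0⇒t≡2p x≋0
      bound : n ≡ 1ℤ × p ≡ 1ℤ
      bound = descent-arith-degenerate 0<n 0<p 0≤u
                (subst (λ z → n * z * z + + 2 * n * p * u ≤ + 2 * z + + 2 * u) t≡2p
                       (descent-bound-weak (ℤP.≤-reflexive (x≋0⇒ttB₀≡4PP x≋0))))
      n≡1 : n ≡ 1ℤ
      n≡1 = proj₁ bound
      p≡1 : p ≡ 1ℤ
      p≡1 = proj₂ bound
      2≤c : + 2 ≤ c
      2≤c = subst (_≤ c) (trans t≡2p (cong (+ 2 *_) p≡1)) t≤c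

    x≉0⇒c≡1 : ¬ x ≋ (λ _ → 0ℤ) → c ≡ 1ℤ
    x≉0⇒c≡1 x≉0 = [ (λ u≡0 → trans c≡t+u (cong₂ _+_ t≡1 u≡0))
                   , (λ p≡1 → [ (λ c≡1 → c≡1) , (λ c≡-1 → ⊥-elim (ℤP.<⇒≱ ℤ.-<+ (subst (1ℤ ≤_) c≡-1 1≤c))) ]′
                                (c≡±1 n≡1 p≡1)) ]′ u≡0⊎p≡1
      where
      x-nonzero : ∃ λ k → x k ≢ 0ℤ
      x-nonzero = FP.¬∀⟶∃¬ l (λ k → x k ≡ 0ℤ) (λ k → x k ℤ.≟ 0ℤ) x≉0
      ttB₀<4PP : t * t * B₀ < + 4 * form D P P
      ttB₀<4PP = 0<j-i⇒i<j (subst (0ℤ <_) form-x (B-posdef x x-nonzero))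
      bound : n ≡ 1ℤ × t ≡ 1ℤ × (u ≡ 0ℤ ⊎ p ≡ 1ℤ)
      bound = descent-arith-strict 0<n 0<t 0<p 0≤u (descent-bound-strict ttB₀<4PP)
      n≡1 : n ≡ 1ℤ
      n≡1 = proj₁ bound
      t≡1 : t ≡ 1ℤ
      t≡1 = proj₁ (proj₂ bound)
      u≡0⊎p≡1 : u ≡ 0ℤ ⊎ p ≡ 1ℤ
      u≡0⊎p≡1 = proj₂ (proj₂ bound)
      1≤c : 1ℤ ≤ c
      1≤c = subst (_≤ c) t≡1 t≤c

    c≡1 : c ≡ 1ℤ
    c≡1 = [ ⊥-elim ∘ x≋0⇒⊥ , x≉0⇒c≡1 ]′ (toSum (≋-dec x (λ _ → 0ℤ)))

    δ′ : Vect l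
    δ′ = sref D j₀ δ

    δ′≋δ-αj₀ : δ′ ≋ (λ k → δ k - e j₀ k)
    δ′≋δ-αj₀ k = cong (λ z → δ k - z) (trans (cong (_* e j₀ k) c≡1) (ℤP.*-identityˡ (e j₀ k)))

    δ′j₀≡ : δ′ j₀ ≡ δ j₀ - 1ℤ
    δ′j₀≡ = trans (δ′≋δ-αj₀ j₀) (cong (λ z → δ j₀ - z) (e-diag j₀))

    0<δj₀ : 0ℤ < δ j₀
    0<δj₀ = subst (0ℤ <_) (sym δj₀≡p) 0<p

    δ′-neg : SomeNeg δ′
    δ′-neg = let (j , δj<0) = neg in
      j , subst (_< 0ℤ) (sym (sref-off j₀ δ j (λ { refl → ℤP.<-asym δj<0 0<δj₀ }))) δj<0

    δ′-pos : SomePos δ′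
    δ′-pos = [ (λ found → found)
             , (λ none → ⊥-elim (δ′≤0⇒⊥ (λ k → ℤP.≮⇒≥ (λ 0<δ′k → none (k , 0<δ′k))))) ]′
             (toSum (FP.any? (λ k → 0ℤ ℤP.<? δ′ k)))
      where
      δ′≤0⇒⊥ : (∀ k → δ′ k ≤ 0ℤ) → ⊥
      δ′≤0⇒⊥ δ′≤0 = ℤP.<⇒≱ (ℤ.+<+ (s≤s (s≤s z≤n))) (subst (+ 2 ≤_) c≡1 2≤c)
        where
        δj₀≡1 : δ j₀ ≡ 1ℤ
        δj₀≡1 = ℤP.≤-antisym (ℤP.i-j≤0⇒i≤j (subst (_≤ 0ℤ) δ′j₀≡ (δ′≤0 j₀))) (ℤP.i<j⇒suc[i]≤j 0<δj₀)
        P≋e : P ≋ e j₀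
        P≋e = ≋e-intro j₀ (trans (sym δj₀≡p) δj₀≡1)
                (λ k j₀≢k → ≤0⇒pos-part≡0 (subst (_≤ 0ℤ) (sref-off j₀ δ k j₀≢k) (δ′≤0 k)))
        2≤c : + 2 ≤ c
        2≤c = subst (_≤ c) (trans (pairCo-cong P≋e j₀) (trans (pairCo-e j₀ j₀) (A-diag j₀))) t≤c

    posMass-δ′ : posMass δ′ ≡ posMass δ - 1ℤ
    posMass-δ′ = begin
      posMass δ′                           ≡⟨ sumF-cong pointwise ⟩
      sumF (λ k → pos-part (δ k) - e j₀ k) ≡⟨ sumF-minus (λ k → pos-part (δ k)) (e j₀) ⟩
      posMass δ - sumF (e j₀)              ≡⟨ cong (λ z → posMass δ - z) (sumF-e j₀) ⟩
      posMass δ - 1ℤ                       ∎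
      where
      open ≡-Reasoning
      pointwise : ∀ k → pos-part (δ′ k) ≡ pos-part (δ k) - e j₀ k
      pointwise k = [ (λ { refl → trans (cong pos-part δ′j₀≡) (trans (pos-part-pred 0<δj₀)
                                (cong (λ z → pos-part (δ j₀) - z) (sym (e-diag j₀)))) })
                    , (λ j₀≢k → trans (cong pos-part (sref-off j₀ δ k j₀≢k))
                         (trans (sym (ℤP.+-identityʳ _)) (cong (λ z → pos-part (δ k) - z) (sym (e-off j₀ k j₀≢k))))) ]′
                      (toSum (j₀ ≟ k))

  no-mixed-root : ∀ b {δ} → posMass δ ≤ + b → IsRoot D δ → SomePos δ → SomeNeg δ → ⊥
  no-mixed-root zero {δ} mass≤0 root (j , 0<δj) neg =
    ℤP.<⇒≱ (ℤP.<-≤-trans (subst (0ℤ <_) (sym (0<⇒pos-part≡ 0<δj)) 0<δj)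
                          (term≤sumF (λ k → pos-part (δ k)) (λ k → pos-part-nonNeg (δ k)) j)) mass≤0
  no-mixed-root (suc b) {δ} mass≤1+b root pos neg =
    no-mixed-root b (subst (_≤ + b) (sym posMass-δ′) (ℤP.+-monoˡ-≤ -1ℤ mass≤1+b))
                  (IsRoot-sref j₀ root) δ′-pos δ′-neg
    where open MixedRoot root pos neg

  root-sign : ∀ {δ} → IsRoot D δ → AllNonNeg δ ⊎ AllNonPos δ
  root-sign {δ} root with SomeNeg? δ | FP.any? (λ j → 0ℤ ℤP.<? δ j)
  ... | no ¬neg  | _       = inj₁ (¬SomeNeg⇒AllNonNeg ¬neg)
  ... | yes _    | no ¬pos = inj₂ (λ j → ℤP.≮⇒≥ (λ 0<δj → ¬pos (j , 0<δj)))
  ... | yes neg  | yes pos = ⊥-elim (no-mixed-root ∣ posMass δ ∣ mass≤ root pos neg)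
    where
    mass≤ : posMass δ ≤ + ∣ posMass δ ∣
    mass≤ = ℤP.≤-reflexive (sym (ℤP.0≤i⇒+∣i∣≡i (sumF-nonNeg _ (λ k → pos-part-nonNeg (δ k)))))

  nonNeg-root-off : ∀ {β} i → IsRoot D β → AllNonNeg β → ¬ β ≋ e i → ∃ λ j → i ≢ j × 0ℤ < β j
  nonNeg-root-off {β} i root β≥0 β≉e =
    [ (λ found → found) , (λ none → ⊥-elim (supported⇒⊥ none)) ]′
    (toSum (FP.any? (λ j → ¬? (i ≟ j) ×-dec (0ℤ ℤP.<? β j))))
    where
    supported⇒⊥ : ¬ (∃ λ j → i ≢ j × 0ℤ < β j) → ⊥
    supported⇒⊥ none = [ β≉e , (λ β≋-e → 0≰-1 (subst (0ℤ ≤_) (trans (β≋-e i) (cong -_ (e-diag i))) (β≥0 i))) ]′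
      (supported-at⇒±e i root (λ j i≢j → ℤP.≤-antisym (ℤP.≮⇒≥ (λ 0<βj → none (j , i≢j , 0<βj))) (β≥0 j)))

  nonPos-root-off : ∀ {β} i → IsRoot D β → AllNonPos β → ¬ β ≋ (λ j → - e i j) → ∃ λ j → i ≢ j × β j < 0ℤ
  nonPos-root-off {β} i root β≤0 β≉-e =
    let (j , i≢j , 0<-βj) = nonNeg-root-off i (IsRoot-neg root) (λ j → ℤP.neg-mono-≤ (β≤0 j)) -β≉e
    in j , i≢j , ℤP.neg-cancel-< 0<-βj
    where
    -β≉e : ¬ (λ j → - β j) ≋ e i
    -β≉e -β≋e = β≉-e (λ j → trans (sym (ℤP.neg-involutive (β j))) (cong -_ (-β≋e j)))

  sref-AllNonNeg : ∀ {β} i → IsRoot D β → AllNonNeg β → ¬ β ≋ e i → AllNonNeg (sref D i β)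
  sref-AllNonNeg {β} i root β≥0 β≉e =
    let (j , i≢j , 0<βj) = nonNeg-root-off i root β≥0 β≉e in
    [ (λ sβ≥0 → sβ≥0)
    , (λ sβ≤0 → ⊥-elim (ℤP.<⇒≱ 0<βj (subst (_≤ 0ℤ) (sref-off i β j i≢j) (sβ≤0 j)))) ]′
    (root-sign (IsRoot-sref i root))

  sref-SomeNeg : ∀ {ν} i → IsRoot D ν → SomeNeg ν → ¬ ν ≋ (λ j → - e i j) → SomeNeg (sref D i ν)
  sref-SomeNeg {ν} i root neg ν≉-e =
    [ (λ ν≥0 → ⊥-elim (AllNonNeg⇒¬SomeNeg ν≥0 neg))
    , (λ ν≤0 → let (j , i≢j , νj<0) = nonPos-root-off i root ν≤0 ν≉-e in
               j , subst (_< 0ℤ) (sym (sref-off i ν j i≢j)) νj<0) ]′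
    (root-sign root)

  SomeNeg-sref⇒≋e : ∀ {γ} i → IsRoot D γ → AllNonNeg γ → SomeNeg (sref D i γ) → γ ≋ e i
  SomeNeg-sref⇒≋e {γ} i root γ≥0 neg =
    [ (λ γ≋e → γ≋e) , (λ γ≉e → ⊥-elim (AllNonNeg⇒¬SomeNeg (sref-AllNonNeg i root γ≥0 γ≉e) neg)) ]′
    (toSum (≋-dec γ (e i)))

  record InversionFamily (w : List (Fin l)) (k : ℕ) : Set where
    field
      root     : Fin k → Vect l
      isRoot   : ∀ a → IsRoot D (root a)
      nonNeg   : ∀ a → AllNonNeg (root a)
      distinct : ∀ a b → root a ≋ root b → a ≡ b
      inverted : ∀ a → SomeNeg (act D w (root a))

  module _ {i : Fin l} {u : List (Fin l)} where

    uninverted⇒simple : ∀ {k} (F : InversionFamily (i ∷ u) k) a →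
      ¬ SomeNeg (act D u (InversionFamily.root F a)) → act D u (InversionFamily.root F a) ≋ e i
    uninverted⇒simple F a ¬neg =
      SomeNeg-sref⇒≋e i (IsRoot-act u (isRoot a)) (¬SomeNeg⇒AllNonNeg ¬neg) (inverted a)
      where open InversionFamily F

    all-inverted : ∀ {k} (F : InversionFamily (i ∷ u) k) →
      (∀ a → SomeNeg (act D u (InversionFamily.root F a))) → InversionFamily u k
    all-inverted F inv = record { InversionFamily F; inverted = inv }

    -- At most one member of the family is not yet inverted by u: it is sent to α_i.
    drop-uninverted : ∀ {k} (F : InversionFamily (i ∷ u) (suc k)) a₀ →
      ¬ SomeNeg (act D u (InversionFamily.root F a₀)) → InversionFamily u k
    drop-uninverted F a₀ ¬neg₀ = record
      { root     = root ∘ punchIn a₀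
      ; isRoot   = isRoot ∘ punchIn a₀
      ; nonNeg   = nonNeg ∘ punchIn a₀
      ; distinct = λ b b′ h → FP.punchIn-injective a₀ b b′ (distinct _ _ h)
      ; inverted = λ b → [ (λ neg → neg) , (λ ¬neg → ⊥-elim (FP.punchInᵢ≢i a₀ b (collision b ¬neg))) ]′
                           (toSum (SomeNeg? (act D u (root (punchIn a₀ b)))))
      }
      where
      open InversionFamily F
      collision : ∀ b → ¬ SomeNeg (act D u (root (punchIn a₀ b))) → punchIn a₀ b ≡ a₀
      collision b ¬neg = distinct _ _ (act-injective u
        (≋-trans (uninverted⇒simple F (punchIn a₀ b) ¬neg) (≋-sym (uninverted⇒simple F a₀ ¬neg₀))))

  inversions≤length : ∀ {w k} → InversionFamily w k → k ℕ.≤ length w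
  inversions≤length {[]}    {zero}  F = z≤n
  inversions≤length {[]}    {suc k} F = ⊥-elim (AllNonNeg⇒¬SomeNeg (nonNeg zero) (inverted zero))
    where open InversionFamily F
  inversions≤length {i ∷ u} {zero}  F = z≤n
  inversions≤length {i ∷ u} {suc k} F =
    [ (λ (a₀ , ¬neg₀) → s≤s (inversions≤length (drop-uninverted F a₀ ¬neg₀)))
    , (λ none → ℕP.m≤n⇒m≤1+n (inversions≤length (all-inverted F (λ a →
          [ (λ neg → neg) , (λ ¬neg → ⊥-elim (none (a , ¬neg))) ]′ (toSum (SomeNeg? (act D u (root a))))))))
    ]′ (toSum (FP.any? (λ a → ¬? (SomeNeg? (act D u (root a))))))
    where open InversionFamily F

  RepresentsRefl-cong : ∀ {β β′} w → β ≋ β′ → RepresentsRefl D β w → RepresentsRefl D β′ w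
  RepresentsRefl-cong {β} {β′} w β≋β′ rep x j = begin
    form D β′ β′ * act D w x j                ≡⟨ cong (_* act D w x j) (form-cong (≋-sym β≋β′) (≋-sym β≋β′)) ⟩
    form D β β * act D w x j                  ≡⟨ rep x j ⟩
    form D β β * x j - + 2 * form D x β * β j ≡⟨ cong₂ (λ a b → a * x j - + 2 * b * β j)
                                                        (form-cong β≋β′ β≋β′) (form-cong {x} ≋-refl β≋β′) ⟩
    form D β′ β′ * x j - + 2 * form D x β′ * β j  ≡⟨ cong (λ z → form D β′ β′ * x j - + 2 * form D x β′ * z) (β≋β′ j) ⟩
    form D β′ β′ * x j - + 2 * form D x β′ * β′ j ∎
    where open ≡-Reasoning

  RepresentsRefl-act : ∀ {α} w → RepresentsRefl D α w → IsRoot D α → ∀ x c →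
    + 2 * form D x α ≡ c * form D α α → act D w x ≋ (λ j → x j - c * α j)
  RepresentsRefl-act {α} w rep root x c 2⟨x,α⟩≡cN j = *-cancelˡ-≡-pos _ _ (IsRoot-norm-pos root) (begin
    N * act D w x j                  ≡⟨ rep x j ⟩
    N * x j - + 2 * form D x α * α j ≡⟨ cong (λ z → N * x j - z * α j) 2⟨x,α⟩≡cN ⟩
    N * x j - c * N * α j            ≡⟨ factor N (x j) c (α j) ⟩
    N * (x j - c * α j)              ∎)
    where
    open ≡-Reasoning
    N : ℤ
    N = form D α α
    factor : ∀ N a c b → N * a - c * N * b ≡ N * (a - c * b)
    factor = solve-∀

  RepresentsRefl-unique : ∀ {α} w w′ → RepresentsRefl D α w → RepresentsRefl D α w′ → IsRoot D α →
    ∀ x → act D w′ x ≋ act D w x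
  RepresentsRefl-unique w w′ rep rep′ root x j =
    *-cancelˡ-≡-pos _ _ (IsRoot-norm-pos root) (trans (rep′ x j) (sym (rep x j)))

  RepresentsRefl-e : ∀ i → RepresentsRefl D (e i) (i ∷ [])
  RepresentsRefl-e i x j = begin
    form D (e i) (e i) * (x j - pairCo D x i * e i j)       ≡⟨ cong (_* (x j - pairCo D x i * e i j)) (form-ee i i) ⟩
    B i i * (x j - pairCo D x i * e i j)                    ≡⟨ distrib (B i i) (x j) (pairCo D x i) (e i j) ⟩
    B i i * x j - pairCo D x i * B i i * e i j              ≡⟨ cong₂ (λ a b → a * x j - b * e i j) (sym (form-ee i i)) (pairCo-cartan x i) ⟩
    form D (e i) (e i) * x j - + 2 * form D x (e i) * e i j ∎
    where
    open ≡-Reasoning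
    distrib : ∀ B a p E → B * (a - p * E) ≡ B * a - p * B * E
    distrib = solve-∀

  RepresentsRefl-conj : ∀ {α} i w → RepresentsRefl D α w → RepresentsRefl D (sref D i α) (i ∷ w ++ i ∷ [])
  RepresentsRefl-conj {α} i w rep x j = begin
    form D (sref D i α) (sref D i α) * sref D i (act D (w ++ i ∷ []) x) j
      ≡⟨ cong₂ _*_ (form-sref i α α) (sref-cong i (act-++ w (i ∷ []) x) j) ⟩
    N * sref D i (act D w y) j
      ≡⟨ sref-* i N (act D w y) j ⟨
    sref D i (λ k → N * act D w y k) j
      ≡⟨ sref-cong i (rep y) j ⟩
    sref D i (λ k → N * y k - c * α k) j
      ≡⟨ sref-minus-* i (λ k → N * y k) c α j ⟩
    sref D i (λ k → N * y k) j - c * sref D i α j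
      ≡⟨ cong (λ z → z - c * sref D i α j) (trans (sref-* i N y j) (cong (N *_) (sref-involutive i x j))) ⟩
    N * x j - c * sref D i α j
      ≡⟨ cong₂ (λ a b → a * x j - + 2 * b * sref D i α j) (sym (form-sref i α α)) (form-sref-adjoint i x α) ⟩
    form D (sref D i α) (sref D i α) * x j - + 2 * form D x (sref D i α) * sref D i α j
      ∎
    where
    open ≡-Reasoning
    y : Vect l
    y = sref D i x
    N c : ℤ
    N = form D α α
    c = + 2 * form D y α

  RepresentsRefl-unconj : ∀ {β} j w → RepresentsRefl D (sref D j β) w → RepresentsRefl D β (j ∷ w ++ j ∷ [])
  RepresentsRefl-unconj {β} j w rep =
    RepresentsRefl-cong (j ∷ w ++ j ∷ []) (sref-involutive j β) (RepresentsRefl-conj j w rep)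

  -- Good chains

  good-step-pairCoroot : ∀ {α m} i → IsRoot D α → CorootCoeffs D α m →
    + 2 * form D (e i) α ≡ - form D α α → pairCoroot m i ≡ -1ℤ
  good-step-pairCoroot {α} {m} i root coeffs good = *-cancelʳ-≡-pos _ _ (IsRoot-norm-pos root) (begin
    pairCoroot m i * form D α α ≡⟨ pairCoroot-form {α} {m} coeffs i ⟩
    + 2 * form D α (e i)        ≡⟨ cong (+ 2 *_) (form-sym α (e i)) ⟩
    + 2 * form D (e i) α        ≡⟨ good ⟩
    - form D α α                ≡⟨ ℤP.-1*i≡-i (form D α α) ⟨
    -1ℤ * form D α α            ∎)
    where open ≡-Reasoning

  CorootCoeffs-good-step : ∀ {α m} i → IsRoot D α → CorootCoeffs D α m →
    + 2 * form D (e i) α ≡ - form D α α → CorootCoeffs D (sref D i α) (λ k → m k + e i k)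
  CorootCoeffs-good-step {α} {m} i root coeffs good =
    CorootCoeffs-cong {sref D i α} {sref D i α} {λ k → m k - pairCoroot m i * e i k} ≋-refl
      (λ k → trans (cong (λ z → m k - z * e i k) (good-step-pairCoroot {m = m} i root coeffs good)) (minus-neg (m k) (e i k)))
      (CorootCoeffs-sref i {α} {m} coeffs)
    where minus-neg : ∀ a b → a - -1ℤ * b ≡ a + b
          minus-neg = solve-∀

  CorootCoeffs-chain : ∀ is {β m} → IsRoot D β → CorootCoeffs D β m → GoodChain D β is →
    CorootCoeffs D (endRoot D β is) (λ k → m k + + countIdx k is)
  CorootCoeffs-chain []       {β} {m} root coeffs _ =
    CorootCoeffs-cong {β} {β} {m} ≋-refl (λ k → sym (ℤP.+-identityʳ (m k))) coeffs
  CorootCoeffs-chain (i ∷ is) {β} {m} root coeffs (good , goods) =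
    CorootCoeffs-cong {m = λ k → m k + e i k + + countIdx k is} (≋-refl {x = endRoot D (sref D i β) is})
      (λ k → trans (ℤP.+-assoc (m k) (e i k) _) (cong (λ z → m k + z) (sym (countIdx-cons k i is))))
      (CorootCoeffs-chain is {m = λ k → m k + e i k} (IsRoot-sref i root) (CorootCoeffs-good-step {β} {m} i root coeffs good) goods)

  pairCoroot≡1⇒good-step : ∀ {α m} j → CorootCoeffs D α m → pairCoroot m j ≡ 1ℤ →
    + 2 * form D (e j) (sref D j α) ≡ - form D (sref D j α) (sref D j α)
  pairCoroot≡1⇒good-step {α} {m} j coeffs n≡1 = begin
    + 2 * form D (e j) (sref D j α)    ≡⟨ cong (+ 2 *_) (form-sref-e j α) ⟩
    + 2 * - form D (e j) α             ≡⟨ ℤP.neg-distribʳ-* (+ 2) (form D (e j) α) ⟨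
    - (+ 2 * form D (e j) α)           ≡⟨ cong (λ z → - (+ 2 * z)) (form-sym (e j) α) ⟩
    - (+ 2 * form D α (e j))           ≡⟨ cong -_ (pairCoroot-form {α} {m} coeffs j) ⟨
    - (pairCoroot m j * form D α α)    ≡⟨ cong (λ z → - (z * form D α α)) n≡1 ⟩
    - (1ℤ * form D α α)                ≡⟨ cong -_ (trans (ℤP.*-identityˡ (form D α α)) (sym (form-sref j α α))) ⟩
    - form D (sref D j α) (sref D j α) ∎
    where open ≡-Reasoning

  HasGoodChain : Vect l → Set
  HasGoodChain α = ∃₂ λ (i₁ : Fin l) (rest : List (Fin l)) →
    1 ℕ.≤ length rest × α ≋ endRoot D (e i₁) rest × GoodChain D (e i₁) rest

  endRoot-snoc : ∀ β is j → endRoot D β (is ++ j ∷ []) ≡ sref D j (endRoot D β is)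
  endRoot-snoc β []       j = refl
  endRoot-snoc β (i ∷ is) j = endRoot-snoc (sref D i β) is j

  GoodChain-snoc : ∀ β is j → GoodChain D β is →
    + 2 * form D (e j) (endRoot D β is) ≡ - form D (endRoot D β is) (endRoot D β is) →
    GoodChain D β (is ++ j ∷ [])
  GoodChain-snoc β []       j _              good = good , tt
  GoodChain-snoc β (i ∷ is) j (good₁ , goods) good = good₁ , GoodChain-snoc (sref D i β) is j goods good

  good-step-cong : ∀ {α β} j → α ≋ β → + 2 * form D (e j) α ≡ - form D α α → + 2 * form D (e j) β ≡ - form D β β
  good-step-cong j α≋β good =
    trans (cong (+ 2 *_) (form-cong {e j} ≋-refl (≋-sym α≋β))) (trans good (cong -_ (form-cong α≋β α≋β)))

  HasGoodChain-step : ∀ {α} j → + 2 * form D (e j) α ≡ - form D α α →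
    IsSimple D α ⊎ HasGoodChain α → HasGoodChain (sref D j α)
  HasGoodChain-step j good (inj₁ (i₁ , α≋e)) =
    i₁ , j ∷ [] , s≤s z≤n , sref-cong j α≋e , good-step-cong j α≋e good , tt
  HasGoodChain-step j good (inj₂ (i₁ , rest , 1≤len , α≋ , goods)) =
    i₁ , rest ++ j ∷ [] ,
    subst (1 ℕ.≤_) (sym (LP.length-++ rest)) (ℕP.m≤n+m 1 (length rest)) ,
    (λ k → trans (sref-cong j α≋ k) (cong (λ z → z k) (sym (endRoot-snoc (e i₁) rest j)))) ,
    GoodChain-snoc (e i₁) rest j goods (good-step-cong j α≋ good)

  HasGoodChain-cong : ∀ {α β} → α ≋ β → HasGoodChain α → HasGoodChain β
  HasGoodChain-cong α≋β (i₁ , rest , 1≤len , α≋ , goods) = i₁ , rest , 1≤len , ≋-trans (≋-sym α≋β) α≋ , goods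

  -- A word for s_β of length 2 ht(β^∨) - 1 which is reduced, as it inverts that many positive roots.
  record TildeCert (β : Vect l) (w : List (Fin l)) : Set where
    field
      isRoot     : IsRoot D β
      nonNeg     : AllNonNeg β
      represents : RepresentsRefl D β w
      inversions : InversionFamily w (length w)
      coeffs     : Vect l
      isCoeffs   : CorootCoeffs D β coeffs
      length≡    : + length w ≡ + 2 * sumF coeffs - 1ℤ

  TildeCert-e : ∀ i → TildeCert (e i) (i ∷ [])
  TildeCert-e i = record
    { isRoot     = IsRoot-e i
    ; nonNeg     = e-nonNeg i
    ; represents = RepresentsRefl-e i
    ; inversions = record
      { root     = λ _ → e i
      ; isRoot   = λ _ → IsRoot-e i
      ; nonNeg   = λ _ → e-nonNeg i
      ; distinct = λ { zero zero _ → refl }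
      ; inverted = λ _ → i , subst (_< 0ℤ) (sym (sref-e-self-at i)) ℤ.-<+
      }
    ; coeffs     = e i
    ; isCoeffs   = CorootCoeffs-e i
    ; length≡    = cong (λ z → + 2 * z - 1ℤ) (sym (sumF-e i))
    }

  TildeCert-cong : ∀ {α β w} → α ≋ β → TildeCert α w → TildeCert β w
  TildeCert-cong {α} {β} {w} α≋β cert = record
    { isRoot     = IsRoot-cong α≋β isRoot
    ; nonNeg     = AllNonNeg-cong α≋β nonNeg
    ; represents = RepresentsRefl-cong w α≋β represents
    ; inversions = inversions
    ; coeffs     = coeffs
    ; isCoeffs   = CorootCoeffs-cong {m = coeffs} α≋β ≋-refl isCoeffs
    ; length≡    = length≡
    }
    where open TildeCert cert

  TildeCert⇒Reduced : ∀ {β w} → TildeCert β w → Reduced D w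
  TildeCert⇒Reduced cert w′ w′≈w = inversions≤length {w′} (record
    { InversionFamily inversions
    ; inverted = λ a → SomeNeg-cong (≋-sym (w′≈w (InversionFamily.root inversions a)))
                                    (InversionFamily.inverted inversions a)
    })
    where open TildeCert cert

  TildeCert⇒InTilde : ∀ {β w} → TildeCert β w → InTilde D β
  TildeCert⇒InTilde {β} {w} cert =
    (isRoot , nonNeg) , length w , sumF coeffs ,
    ((w , refl , represents) ,
     (λ w′ rep′ → TildeCert⇒Reduced cert w′ (RepresentsRefl-unique w w′ represents rep′ isRoot))) ,
    (coeffs , isCoeffs , refl) , length≡
    where open TildeCert cert

  -- With w representing s_α and α_i(α^∨) = -1, the word s_i w s_i represents s_{s_i α} and
  -- inverts α_i, s_i(w(α_i)) and the images under s_i of the inversions of w.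
  module GoodStep {α w} (cert : TildeCert α w) (i : Fin l) (good : + 2 * form D (e i) α ≡ - form D α α) where
    open TildeCert cert
    open InversionFamily inversions renaming (root to inv; isRoot to inv-isRoot; nonNeg to inv-nonNeg)

    w′ : List (Fin l)
    w′ = i ∷ w ++ i ∷ []

    act-w′ : ∀ y → act D w′ y ≋ sref D i (act D w (sref D i y))
    act-w′ y = sref-cong i (act-++ w (i ∷ []) y)

    pc<0 : pairCo D α i < 0ℤ
    pc<0 = i*k<0⇒i<0 (B-diag-pos i) (subst (_< 0ℤ) (sym pcB≡-N) (ℤP.neg-mono-< (IsRoot-norm-pos isRoot)))
      where
      pcB≡-N : pairCo D α i * B i i ≡ - form D α α
      pcB≡-N = trans (pairCo-cartan α i) (trans (cong (+ 2 *_) (form-sym α (e i))) good)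

    w-e : act D w (e i) ≋ (λ j → e i j + α j)
    w-e j = trans (RepresentsRefl-act w represents isRoot (e i) -1ℤ (trans good (sym (ℤP.-1*i≡-i _))) j)
                  (minus-neg (e i j) (α j))
      where minus-neg : ∀ a b → a - -1ℤ * b ≡ a + b
            minus-neg = solve-∀

    w-α : act D w α ≋ (λ j → - α j)
    w-α j = trans (RepresentsRefl-act w represents isRoot α (+ 2) refl j) (reflect (α j))
      where reflect : ∀ a → a - + 2 * a ≡ - a
            reflect = solve-∀

    w-e+α : act D w (λ j → e i j + α j) ≋ e i
    w-e+α j = trans (act-+ w (e i) α j) (trans (cong₂ _+_ (w-e j) (w-α j)) (cancel (e i j) (α j)))
      where cancel : ∀ a b → a + b + - b ≡ a
            cancel = solve-∀

    g : Vect l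
    g = sref D i (act D w (e i))

    g≋ : g ≋ (λ j → α j + (-1ℤ - pairCo D α i) * e i j)
    g≋ j = trans (sref-cong i w-e j)
      (trans (cong (λ z → e i j + α j - z * e i j)
                   (trans (pairCo-+ (e i) α i) (cong (_+ pairCo D α i) (trans (pairCo-e i i) (A-diag i)))))
             (regroup (e i j) (α j) (pairCo D α i)))
      where regroup : ∀ E a p → E + a - (+ 2 + p) * E ≡ a + (-1ℤ - p) * E
            regroup = solve-∀

    g≥0 : AllNonNeg g
    g≥0 j = subst (0ℤ ≤_) (sym (g≋ j)) (ℤP.+-mono-≤ (nonNeg j)
              (ℤP.*-monoʳ-≤-nonNeg (e i j) {{ℤ.nonNegative (e-nonNeg i j)}} 0≤-1-pc))
      where
      0≤-1-pc : 0ℤ ≤ -1ℤ - pairCo D α i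
      0≤-1-pc = subst (0ℤ ≤_) (rearrange (pairCo D α i)) (ℤP.neg-mono-≤ (ℤP.i<j⇒suc[i]≤j pc<0))
        where rearrange : ∀ p → - (1ℤ + p) ≡ -1ℤ - p
              rearrange = solve-∀

    g-off : ∀ j → i ≢ j → g j ≡ α j
    g-off j i≢j = trans (g≋ j) (trans (cong (λ z → α j + (-1ℤ - pairCo D α i) * z) (e-off i j i≢j))
                               (trans (cong (λ z → α j + z) (ℤP.*-zeroʳ (-1ℤ - pairCo D α i))) (ℤP.+-identityʳ (α j))))

    α-off : ∃ λ j → i ≢ j × 0ℤ < α j
    α-off = nonNeg-root-off i isRoot nonNeg λ α≋e →
      ℤP.<-asym pc<0 (subst (0ℤ <_) (sym (trans (pairCo-cong α≋e i) (trans (pairCo-e i i) (A-diag i))))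
                                    (ℤ.+<+ (s≤s z≤n)))

    sα≥0 : AllNonNeg (sref D i α)
    sα≥0 j = subst (0ℤ ≤_) (sym (regroup (α j) (pairCo D α i) (e i j)))
               (ℤP.+-mono-≤ (nonNeg j) (ℤP.*-monoʳ-≤-nonNeg (e i j) {{ℤ.nonNegative (e-nonNeg i j)}}
                                          (ℤP.neg-mono-≤ (ℤP.<⇒≤ pc<0))))
      where regroup : ∀ a p E → a - p * E ≡ a + (- p) * E
            regroup = solve-∀

    family : Fin (2 ℕ.+ length w) → Vect l
    family zero          = e i
    family (suc zero)    = g
    family (suc (suc a)) = sref D i (inv a)

    family-isRoot : ∀ a → IsRoot D (family a)
    family-isRoot zero          = IsRoot-e i
    family-isRoot (suc zero)    = IsRoot-sref i (IsRoot-act w (IsRoot-e i))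
    family-isRoot (suc (suc a)) = IsRoot-sref i (inv-isRoot a)

    inv≉e : ∀ a → ¬ inv a ≋ e i
    inv≉e a inv≋e = AllNonNeg⇒¬SomeNeg (AllNonNeg-cong (≋-sym w-e) (λ j → ℤP.+-mono-≤ (e-nonNeg i j) (nonNeg j)))
                                       (SomeNeg-cong (act-cong w inv≋e) (inverted a))

    family-nonNeg : ∀ a → AllNonNeg (family a)
    family-nonNeg zero          = e-nonNeg i
    family-nonNeg (suc zero)    = g≥0
    family-nonNeg (suc (suc a)) = sref-AllNonNeg i (inv-isRoot a) (inv-nonNeg a) (inv≉e a)

    e≉g : ¬ e i ≋ g
    e≉g e≋g = let (j , i≢j , 0<αj) = α-off in
      ℤP.<-irrefl (trans (sym (e-off i j i≢j)) (trans (e≋g j) (g-off j i≢j))) 0<αj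

    e≉s-inv : ∀ a → ¬ e i ≋ sref D i (inv a)
    e≉s-inv a e≋s = 0≰-1 (subst (0ℤ ≤_) inv-i≡-1 (inv-nonNeg a i))
      where inv-i≡-1 : inv a i ≡ -1ℤ
            inv-i≡-1 = trans (sym (≋-trans (sref-cong i e≋s) (sref-involutive i (inv a)) i)) (sref-e-self-at i)

    g≉s-inv : ∀ a → ¬ g ≋ sref D i (inv a)
    g≉s-inv a g≋s = AllNonNeg⇒¬SomeNeg (AllNonNeg-cong (≋-sym w-inv≋e) (e-nonNeg i)) (inverted a)
      where w-inv≋e : act D w (inv a) ≋ e i
            w-inv≋e = ≋-trans (act-cong w (≋-sym (sref-injective i g≋s))) (≋-trans (act-cong w w-e) w-e+α)

    family-distinct : ∀ a b → family a ≋ family b → a ≡ b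
    family-distinct zero          zero          _ = refl
    family-distinct zero          (suc zero)    h = ⊥-elim (e≉g h)
    family-distinct zero          (suc (suc b)) h = ⊥-elim (e≉s-inv b h)
    family-distinct (suc zero)    zero          h = ⊥-elim (e≉g (≋-sym h))
    family-distinct (suc zero)    (suc zero)    _ = refl
    family-distinct (suc zero)    (suc (suc b)) h = ⊥-elim (g≉s-inv b h)
    family-distinct (suc (suc a)) zero          h = ⊥-elim (e≉s-inv a (≋-sym h))
    family-distinct (suc (suc a)) (suc zero)    h = ⊥-elim (g≉s-inv a (≋-sym h))
    family-distinct (suc (suc a)) (suc (suc b)) h = cong (λ c → suc (suc c)) (distinct a b (sref-injective i h))

    family-inverted : ∀ a → SomeNeg (act D w′ (family a))
    family-inverted zero = let (j , i≢j , 0<αj) = α-off in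
      j , subst (_< 0ℤ) (sym (w′-e j i≢j)) (ℤP.neg-mono-< 0<αj)
      where
      w′-e : ∀ j → i ≢ j → act D w′ (e i) j ≡ - α j
      w′-e j i≢j = trans (act-w′ (e i) j)
        (trans (sref-cong i (≋-trans (act-cong w (sref-e-self i)) (act-neg w (e i))) j)
               (trans (sref-neg i (act D w (e i)) j) (cong -_ (g-off j i≢j))))
    family-inverted (suc zero) = i , subst (_< 0ℤ) (sym w′-g) ℤ.-<+
      where
      w′-g : act D w′ g i ≡ -1ℤ
      w′-g = trans (act-w′ g i)
        (trans (sref-cong i (≋-trans (act-cong w (sref-involutive i (act D w (e i))))
                                       (≋-trans (act-cong w w-e) w-e+α)) i)
               (sref-e-self-at i))
    family-inverted (suc (suc a)) =
      SomeNeg-cong (≋-sym (≋-trans (act-w′ (sref D i (inv a))) (sref-cong i (act-cong w (sref-involutive i (inv a))))))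
                   (sref-SomeNeg i (IsRoot-act w (inv-isRoot a)) (inverted a) w-inv≉-e)
      where
      w-inv≉-e : ¬ act D w (inv a) ≋ (λ j → - e i j)
      w-inv≉-e w-inv≋-e =
        ℤP.<⇒≱ (ℤP.neg-mono-< (ℤP.<-≤-trans (ℤ.+<+ (s≤s z≤n)) 1≤e+α)) (subst (0ℤ ≤_) inv≡ (inv-nonNeg a i))
        where
        inv≡ : inv a i ≡ - (e i i + α i)
        inv≡ = act-injective w (≋-trans w-inv≋-e
                 (≋-sym (≋-trans (act-neg w (λ j → e i j + α j)) (λ j → cong -_ (w-e+α j))))) i
        1≤e+α : 1ℤ ≤ e i i + α i
        1≤e+α = subst (λ z → 1ℤ ≤ z + α i) (sym (e-diag i)) (ℤP.i≤i+j 1ℤ (α i) {{ℤ.nonNegative (nonNeg i)}})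

    cert′ : TildeCert (sref D i α) w′
    cert′ = record
      { isRoot     = IsRoot-sref i isRoot
      ; nonNeg     = sα≥0
      ; represents = RepresentsRefl-conj i w represents
      ; inversions = subst (InversionFamily w′) (sym (length-conj i w)) (record
        { root     = family
        ; isRoot   = family-isRoot
        ; nonNeg   = family-nonNeg
        ; distinct = family-distinct
        ; inverted = family-inverted
        })
      ; coeffs     = λ j → coeffs j + e i j
      ; isCoeffs   = CorootCoeffs-good-step {m = coeffs} i isRoot isCoeffs good
      ; length≡    = begin
          + length w′                              ≡⟨ cong +_ (length-conj i w) ⟩
          + 2 + + length w                         ≡⟨ cong (λ z → + 2 + z) length≡ ⟩
          + 2 + (+ 2 * sumF coeffs - 1ℤ)           ≡⟨ regroup (sumF coeffs) ⟩
          + 2 * (sumF coeffs + 1ℤ) - 1ℤ            ≡⟨ cong (λ z → + 2 * (sumF coeffs + z) - 1ℤ) (sumF-e i) ⟨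
          + 2 * (sumF coeffs + sumF (e i)) - 1ℤ    ≡⟨ cong (λ z → + 2 * z - 1ℤ) (sumF-+ coeffs (e i)) ⟨
          + 2 * sumF (λ j → coeffs j + e i j) - 1ℤ ∎
      }
      where
      open ≡-Reasoning
      regroup : ∀ x → + 2 + (+ 2 * x - 1ℤ) ≡ + 2 * (x + 1ℤ) - 1ℤ
      regroup = solve-∀

  TildeCert-chain : ∀ is {β w} → TildeCert β w → GoodChain D β is → TildeCert (endRoot D β is) (reverse is ++ w ++ is)
  TildeCert-chain []       {β} {w} cert _ = subst (TildeCert β) (sym (LP.++-identityʳ w)) cert
  TildeCert-chain (i ∷ is) {β} {w} cert (good , goods) =
    subst (TildeCert (endRoot D (sref D i β) is)) regroup
          (TildeCert-chain is (GoodStep.cert′ cert i good) goods)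
    where
    regroup : reverse is ++ (i ∷ w ++ i ∷ []) ++ is ≡ reverse (i ∷ is) ++ w ++ i ∷ is
    regroup = trans (cong (λ z → reverse is ++ i ∷ z) (LP.++-assoc w (i ∷ []) is))
                    (sym (trans (cong (_++ (w ++ i ∷ is)) (LP.unfold-reverse i is))
                                (LP.++-assoc (reverse is) (i ∷ []) (w ++ i ∷ is))))

  All-InTilde-chainRoots : ∀ is {β w} → TildeCert β w → GoodChain D β is → All (InTilde D) (chainRoots D β is)
  All-InTilde-chainRoots []       cert _               = TildeCert⇒InTilde cert ∷ []
  All-InTilde-chainRoots (i ∷ is) cert (good , goods) =
    TildeCert⇒InTilde cert ∷ All-InTilde-chainRoots is (GoodStep.cert′ cert i good) goods

  TildeCert-goodChain : ∀ {α} i₁ rest → α ≋ endRoot D (e i₁) rest → GoodChain D (e i₁) rest →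
    TildeCert α (reflWord i₁ rest)
  TildeCert-goodChain i₁ rest α≋ goods = TildeCert-cong (≋-sym α≋) (TildeCert-chain rest (TildeCert-e i₁) goods)

  CorootCoeffs-goodChain : ∀ {α} i₁ rest → α ≋ endRoot D (e i₁) rest → GoodChain D (e i₁) rest →
    CorootCoeffs D α (λ i → + countIdx i (i₁ ∷ rest))
  CorootCoeffs-goodChain i₁ rest α≋ goods =
    CorootCoeffs-cong {m = λ k → e i₁ k + + countIdx k rest} (≋-sym α≋) (λ k → sym (countIdx-cons k i₁ rest))
      (CorootCoeffs-chain rest {e i₁} {e i₁} (IsRoot-e i₁) (CorootCoeffs-e i₁) goods)

  -- Descent and the length of reflections

  IsSimple? : ∀ α → Dec (IsSimple D α)
  IsSimple? α = FP.any? (λ i → ≋-dec α (e i))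

  CorootCoeffs-nonNeg : ∀ {β m} → IsRoot D β → AllNonNeg β → CorootCoeffs D β m → AllNonNeg m
  CorootCoeffs-nonNeg {β} {m} root β≥0 coeffs k = 0≤i*k⇒0≤i (IsRoot-norm-pos root)
    (subst (0ℤ ≤_) (sym (coeffs k)) (ℤP.*-monoʳ-≤-nonNeg (B k k) {{ℤ.nonNegative (ℤP.<⇒≤ (B-diag-pos k))}} (β≥0 k)))

  1≤height : ∀ {β m} → IsRoot D β → AllNonNeg β → CorootCoeffs D β m → 1ℤ ≤ sumF m
  1≤height {β} {m} root β≥0 coeffs = let (j , 0<βj , _) = positive-direction β≥0 (IsRoot-norm-pos root) in
    ℤP.≤-trans (ℤP.i<j⇒suc[i]≤j (0<i*k⇒0<i (IsRoot-norm-pos root)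
                                   (subst (0ℤ <_) (sym (coeffs j)) (0<i*j 0<βj (B-diag-pos j)))))
               (term≤sumF m (CorootCoeffs-nonNeg root β≥0 coeffs) j)

  module Descent {β m} (root : IsRoot D β) (β≥0 : AllNonNeg β) (coeffs : CorootCoeffs D β m)
                 (β≉simple : ¬ IsSimple D β) where

    direction : ∃ λ j → 0ℤ < β j × 0ℤ < form D (e j) β
    direction = positive-direction β≥0 (IsRoot-norm-pos root)

    j : Fin l
    j = proj₁ direction

    n : ℤ
    n = pairCoroot m j

    1≤n : 1ℤ ≤ n
    1≤n = ℤP.i<j⇒suc[i]≤j (0<i*k⇒0<i (IsRoot-norm-pos root)
            (subst (0ℤ <_) (sym (trans (pairCoroot-form {β} {m} coeffs j) (cong (+ 2 *_) (form-sym β (e j)))))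
                   (0<i*j {+ 2} (ℤ.+<+ (s≤s z≤n)) (proj₂ (proj₂ direction)))))

    β′ : Vect l
    β′ = sref D j β

    β′-root : IsRoot D β′
    β′-root = IsRoot-sref j root

    β′≥0 : AllNonNeg β′
    β′≥0 = sref-AllNonNeg j root β≥0 (λ β≋e → β≉simple (j , β≋e))

    m′ : Vect l
    m′ k = m k - n * e j k

    β′-coeffs : CorootCoeffs D β′ m′
    β′-coeffs = CorootCoeffs-sref j {β} {m} coeffs

    height-β′ : sumF m′ ≡ sumF m - n
    height-β′ = trans (sumF-minus m (λ k → n * e j k))
                      (cong (λ z → sumF m - z) (trans (sumF-*ˡ n (e j)) (trans (cong (n *_) (sumF-e j)) (ℤP.*-identityʳ n))))

    height-β′≤ : ∀ {b} → sumF m ≤ + suc b → sumF m′ ≤ + b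
    height-β′≤ {b} height≤ = subst (_≤ + b) (sym height-β′)
      (ℤP.≤-trans (ℤP.+-monoʳ-≤ (sumF m) (ℤP.neg-mono-≤ 1≤n)) (ℤP.+-monoˡ-≤ -1ℤ height≤))

  reflection-word : ∀ b {β m} → IsRoot D β → AllNonNeg β → CorootCoeffs D β m → sumF m ≤ + b →
    ∃ λ w → RepresentsRefl D β w × + length w + 1ℤ ≤ + 2 * sumF m
  reflection-word zero    {β} {m} root β≥0 coeffs height≤0 =
    ⊥-elim (ℤP.<⇒≱ (ℤ.+<+ (s≤s z≤n)) (ℤP.≤-trans (1≤height {β} {m} root β≥0 coeffs) height≤0))
  reflection-word (suc b) {β} {m} root β≥0 coeffs height≤ =
    [ simple , nonsimple ]′ (toSum (IsSimple? β))
    where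
    simple : IsSimple D β → ∃ λ w → RepresentsRefl D β w × + length w + 1ℤ ≤ + 2 * sumF m
    simple (i , β≋e) = i ∷ [] , RepresentsRefl-cong (i ∷ []) (≋-sym β≋e) (RepresentsRefl-e i) ,
      subst (_≤ + 2 * sumF m) (ℤP.*-identityʳ (+ 2)) (ℤP.*-monoˡ-≤-nonNeg (+ 2) (1≤height root β≥0 coeffs))
    nonsimple : ¬ IsSimple D β → ∃ λ w → RepresentsRefl D β w × + length w + 1ℤ ≤ + 2 * sumF m
    nonsimple β≉simple =
      let (w′ , rep′ , bound′) = reflection-word b {β′} {m′} β′-root β′≥0 β′-coeffs (height-β′≤ height≤) in
      j ∷ w′ ++ j ∷ [] , RepresentsRefl-unconj j w′ rep′ ,
      subst (λ z → + z + 1ℤ ≤ + 2 * sumF m) (sym (length-conj j w′))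
            (length-bound-conj (+ length w′) (sumF m) n 1≤n (subst (λ z → + length w′ + 1ℤ ≤ + 2 * z) height-β′ bound′))
      where
      open Descent {β} {m} root β≥0 coeffs β≉simple

  long-reflection⇒chain : ∀ b {α m} → IsRoot D α → AllNonNeg α → CorootCoeffs D α m → sumF m ≤ + b →
    (∀ w → RepresentsRefl D α w → + 2 * sumF m - 1ℤ ≤ + length w) → IsSimple D α ⊎ HasGoodChain α
  long-reflection⇒chain zero {α} {m} root α≥0 coeffs height≤0 _ =
    ⊥-elim (ℤP.<⇒≱ (ℤ.+<+ (s≤s z≤n)) (ℤP.≤-trans (1≤height {α} {m} root α≥0 coeffs) height≤0))
  long-reflection⇒chain (suc b) {α} {m} root α≥0 coeffs height≤ long =
    [ inj₁ , (λ α≉simple → inj₂ (nonsimple α≉simple)) ]′ (toSum (IsSimple? α))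
    where
    nonsimple : ¬ IsSimple D α → HasGoodChain α
    nonsimple α≉simple = HasGoodChain-cong (sref-involutive j α)
      (HasGoodChain-step j (pairCoroot≡1⇒good-step {α} {m} j coeffs n≡1)
        (long-reflection⇒chain b {β′} {m′} β′-root β′≥0 β′-coeffs (height-β′≤ height≤) long′))
      where
      open Descent {α} {m} root α≥0 coeffs α≉simple
      long-conj : ∀ v → RepresentsRefl D β′ v → + 2 * sumF m - 1ℤ ≤ + 2 + + length v
      long-conj v rep = subst (+ 2 * sumF m - 1ℤ ≤_) (cong +_ (length-conj j v))
                              (long (j ∷ v ++ j ∷ []) (RepresentsRefl-unconj j v rep))
      n≡1 : n ≡ 1ℤ
      n≡1 = let (w′ , rep′ , bound′) = reflection-word b {β′} {m′} β′-root β′≥0 β′-coeffs (height-β′≤ height≤) in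
        length-bound-conj-tight (+ length w′) (sumF m) n 1≤n (long-conj w′ rep′)
          (subst (λ z → + length w′ + 1ℤ ≤ + 2 * z) height-β′ bound′)
      long′ : ∀ v → RepresentsRefl D β′ v → + 2 * sumF m′ - 1ℤ ≤ + length v
      long′ v rep = subst (λ z → + 2 * z - 1ℤ ≤ + length v) (sym (trans height-β′ (cong (λ z → sumF m - z) n≡1)))
                          (length-lower-conj (+ length v) (sumF m) (long-conj v rep))

  InTilde⇒long-reflection : ∀ {α} → InTilde D α → ∃ λ m → CorootCoeffs D α m ×
    (∀ w → RepresentsRefl D α w → + 2 * sumF m - 1ℤ ≤ + length w)
  InTilde⇒long-reflection (_ , n , h , (_ , minimal) , (m , coeffs , h≡Σm) , n≡2h-1) =
    m , coeffs , λ w rep → subst (_≤ + length w) (trans n≡2h-1 (cong (λ z → + 2 * z - 1ℤ) h≡Σm)) (ℤ.+≤+ (minimal w rep))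

lemma3p1 : ∀ {l} (D : RootDatum l) (α : Vect l) → IsPosRoot D α →
    (InTilde D α ⇔ (IsSimple D α ⊎
       ∃₂ λ (i₁ : Fin l) (rest : List (Fin l)) →
         1 ℕ.≤ length rest × α ≋ endRoot D (e i₁) rest × GoodChain D (e i₁) rest))
    × (∀ (i₁ : Fin l) (rest : List (Fin l)) → 1 ℕ.≤ length rest →
         α ≋ endRoot D (e i₁) rest → GoodChain D (e i₁) rest →
         RepresentsRefl D α (reflWord i₁ rest) × Reduced D (reflWord i₁ rest)
         × CorootCoeffs D α (λ i → + countIdx i (i₁ ∷ rest))
         × CorootHeight D α (+ length (i₁ ∷ rest))
         × All (InTilde D) (chainRoots D (e i₁) rest))
lemma3p1 D α (root , α≥0) = mk⇔ to from , λ i₁ rest _ α≋ goods →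
  let cert   = TildeCert-goodChain D i₁ rest α≋ goods
      coeffs = CorootCoeffs-goodChain D i₁ rest α≋ goods
  in TildeCert.represents cert , TildeCert⇒Reduced D cert , coeffs ,
     (_ , coeffs , sym (sumF-countIdx (i₁ ∷ rest))) ,
     All-InTilde-chainRoots D rest (TildeCert-e D i₁) goods
  where
  to : InTilde D α → IsSimple D α ⊎ HasGoodChain D α
  to tilde = let (m , coeffs , long) = InTilde⇒long-reflection D tilde in
    long-reflection⇒chain D ∣ sumF m ∣ root α≥0 coeffs
      (ℤP.≤-reflexive (sym (ℤP.0≤i⇒+∣i∣≡i (sumF-nonNeg m (CorootCoeffs-nonNeg D root α≥0 coeffs))))) long
  from : IsSimple D α ⊎ HasGoodChain D α → InTilde D α
  from (inj₁ (i , α≋e))                    = TildeCert⇒InTilde D (TildeCert-cong D (≋-sym α≋e) (TildeCert-e D i))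
  from (inj₂ (i₁ , rest , _ , α≋ , goods)) = TildeCert⇒InTilde D (TildeCert-goodChain D i₁ rest α≋ goods)
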